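{- The following problems are expressible in A&C DN logic, i.e., for each of them and each choice of the indicated parameters there is an A&C DN sentence $\varphi$ such that an input graph $G$ (with the indicated unary relations) satisfies $\varphi$ if and only if the instance is a yes-instance: 1. Feedback Vertex Set (given $G$ and $k$: is there $X\subseteq V(G)$ with $|X|\le k$ such that $G-X$ is acyclic?), with $\varphi$ depending on $k$; 2. Longest Induced Path (given $G$ and $k$: does $G$ contain an induced path on $k$ vertices?), with $\varphi$ depending on $k$; 3. Induced Disjoint Paths (given $G$ and terminal pairs $(s_1,t_1),\dots,(s_k,t_k)$, given as unary relations $\mathbf P_i=\{s_i,t_i\}$: are there paths $P_1,\dots,P_k$ such that each $P_i$ is an induced $(s_i,t_i)$-path of $G$ and, for all $i\ne j$, no vertex of $V(P_i)$ has a neighbor in $V(P_j)$, except possibly when terminals coincide?), with $\varphi$ depending on $k$; 4. $H$-Induced Topological Minor for a fixed graph $H$ (does $G$ contain a subdivision of $H$ as an induced subgraph?); 5. Acyclic $k$-Coloring (is there a proper coloring of $G$ with $k$ colors such that every two color classes together induce a forest?), with $\varphi$ depending on $k$.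
   Context: A&C DN logic: existential MSO over vertex-colored graphs (quantification over vertices and vertex sets; atomic $E(x,y)$, $x=y$, $x\in X$, $\mathbf P(x)$; only existential quantifiers; negation only of quantifier-free formulas) extended by size measurements $|t|=m$, $|t|\le m$, $|t|\ge m$ ($m\in\mathbb N$), comparisons $t_1=t_2$, $t_1\subseteq t_2$, $t_1\supseteq t_2$ of neighborhood terms, and atomic formulas $\mathrm{conn}(t)$ (the subgraph induced by the value of $t$ is connected) and $\mathrm{acy}(t)$ (it is acyclic). Neighborhood terms are built from set variables, unary relation symbols and $\emptyset$ by complement, $\cap$, $\cup$, $\setminus$ and $N^r_d(\cdot)$ ($d,r\in\mathbb N^+$), where $N^r_d(U)$ is the set of vertices $v$ having at least $d$ vertices of $U$ among $\{u\ne v:\mathrm{dist}(u,v)\le r\}$. -}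

module Defs where

open import Data.Nat using (ℕ; zero; suc; _≤_; _<_; _≤ᵇ_; _≥_)
open import Data.Bool using (Bool; true; false; _∧_; _∨_; not)
open import Data.Fin using (Fin; zero; suc; toℕ; _≟_)
open import Data.Fin.Subset using (Subset; ∁; _∩_; _∪_; _─_; ∣_∣; _⊆_; _∈_; _∉_; ⊥)
open import Data.Vec using (tabulate; lookup)
open import Data.List using (allFin)
open import Data.Bool.ListAction using (any)
open import Data.Product using (Σ; _×_; _,_)
open import Data.Sum using (_⊎_)
open import Data.Empty renaming (⊥ to Empty)
open import Relation.Nullary using (¬_; ⌊_⌋)
open import Relation.Binary.PropositionalEquality using (_≡_; _≢_)
open import Function.Bundles using (_⇔_)
open import Function.Definitions using (Injective)

record Graph : Set where
  field
    n      : ℕ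
    E      : Fin n → Fin n → Bool
    sym    : ∀ u v → E u v ≡ E v u
    irrefl : ∀ v → E v v ≡ false
open Graph public

record CGraph (σ : ℕ) : Set where
  field
    graph : Graph
    P     : Fin σ → Fin (n graph) → Bool
open CGraph public

plain : Graph → CGraph 0
plain G = record { graph = G ; P = λ () }

Adj : (G : Graph) → Fin (n G) → Fin (n G) → Set
Adj G u v = E G u v ≡ true

record WalkIn (G : Graph) (S : Fin (n G) → Set) (u v : Fin (n G)) : Set where
  field
    len   : ℕ
    w     : Fin (suc len) → Fin (n G)
    start : w zero ≡ u
    end   : w (Data.Fin.fromℕ len) ≡ v
    inS   : ∀ i → S (w i)
    step  : ∀ i j → suc (toℕ i) ≡ toℕ j → Adj G (w i) (w j)

Connected : (G : Graph) → (Fin (n G) → Set) → Set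
Connected G S = ∀ u v → S u → S v → WalkIn G S u v

record CycleIn (G : Graph) (S : Fin (n G) → Set) : Set where
  field
    m     : ℕ
    m≥3   : m ≥ 3
    f     : Fin m → Fin (n G)
    inj   : Injective _≡_ _≡_ f
    inS   : ∀ i → S (f i)
    step  : ∀ i j → (suc (toℕ i) ≡ toℕ j ⊎ (suc (toℕ i) ≡ m × toℕ j ≡ 0))
                  → Adj G (f i) (f j)

Acyclic : (G : Graph) → (Fin (n G) → Set) → Set
Acyclic G S = ¬ CycleIn G S

-- Distances (boolean): reach G r u v = true iff dist(u,v) ≤ r

reach : (G : Graph) → ℕ → Fin (n G) → Fin (n G) → Bool
reach G zero    u v = ⌊ u ≟ v ⌋
reach G (suc r) u v = reach G r u v ∨ any (λ w → reach G r u w ∧ E G w v) (allFin (n G))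

-- N^r_d(U): vertices v with at least d vertices u ≠ v of U with dist(u,v) ≤ r
Nbh : (G : Graph) → ℕ → ℕ → Subset (n G) → Subset (n G)
Nbh G r d U = tabulate λ v →
  d ≤ᵇ ∣ tabulate (λ u → not ⌊ u ≟ v ⌋ ∧ reach G r u v ∧ lookup U u) ∣

-- Syntax of A&C DN logic over σ unary relation symbols.
-- a = number of free vertex variables, b = number of free set variables
-- (de Bruijn indices).

data Term (σ a b : ℕ) : Set where
  svar  : Fin b → Term σ a b
  rel   : Fin σ → Term σ a b
  empty : Term σ a b
  compl : Term σ a b → Term σ a b
  _∩ₜ_  : Term σ a b → Term σ a b → Term σ a b
  _∪ₜ_  : Term σ a b → Term σ a b → Term σ a b
  _∖ₜ_  : Term σ a b → Term σ a b → Term σ a b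
  N     : (d r : ℕ) → 1 ≤ d → 1 ≤ r → Term σ a b → Term σ a b

data QF (σ a b : ℕ) : Set where
  edge   : Fin a → Fin a → QF σ a b
  eqv    : Fin a → Fin a → QF σ a b
  mem    : Fin a → Fin b → QF σ a b
  pred   : Fin σ → Fin a → QF σ a b
  size=  : Term σ a b → ℕ → QF σ a b
  size≤  : Term σ a b → ℕ → QF σ a b
  size≥  : Term σ a b → ℕ → QF σ a b
  teq    : Term σ a b → Term σ a b → QF σ a b
  tsub   : Term σ a b → Term σ a b → QF σ a b
  tsup   : Term σ a b → Term σ a b → QF σ a b
  conn   : Term σ a b → QF σ a b
  acy    : Term σ a b → QF σ a b
  neg    : QF σ a b → QF σ a b
  and    : QF σ a b → QF σ a b → QF σ a b
  or     : QF σ a b → QF σ a b → QF σ a b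

-- existential formulas: negation only inside quantifier-free parts
data Formula (σ a b : ℕ) : Set where
  qf    : QF σ a b → Formula σ a b
  and   : Formula σ a b → Formula σ a b → Formula σ a b
  or    : Formula σ a b → Formula σ a b → Formula σ a b
  exV   : Formula σ (suc a) b → Formula σ a b
  exS   : Formula σ a (suc b) → Formula σ a b

Sentence : ℕ → Set
Sentence σ = Formula σ 0 0

module _ {σ : ℕ} (G : CGraph σ) where
  private
    V = Fin (n (graph G))

  ext : {A : Set} {a : ℕ} → (Fin a → A) → A → Fin (suc a) → A
  ext ρ x zero    = x
  ext ρ x (suc i) = ρ i

  evalT : {a b : ℕ} → (Fin b → Subset (n (graph G))) → Term σ a b → Subset (n (graph G))
  evalT η (svar X)    = η X
  evalT η (rel p)     = tabulate (P G p)
  evalT η empty       = ⊥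
  evalT η (compl t)   = ∁ (evalT η t)
  evalT η (t ∩ₜ u)    = evalT η t ∩ evalT η u
  evalT η (t ∪ₜ u)    = evalT η t ∪ evalT η u
  evalT η (t ∖ₜ u)    = evalT η t ─ evalT η u
  evalT η (N d r _ _ t) = Nbh (graph G) r d (evalT η t)

  evalQF : {a b : ℕ} → (Fin a → V) → (Fin b → Subset (n (graph G))) → QF σ a b → Set
  evalQF ρ η (edge x y)  = Adj (graph G) (ρ x) (ρ y)
  evalQF ρ η (eqv x y)   = ρ x ≡ ρ y
  evalQF ρ η (mem x X)   = ρ x ∈ η X
  evalQF ρ η (pred p x)  = P G p (ρ x) ≡ true
  evalQF ρ η (size= t m) = ∣ evalT η t ∣ ≡ m
  evalQF ρ η (size≤ t m) = ∣ evalT η t ∣ ≤ m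
  evalQF ρ η (size≥ t m) = m ≤ ∣ evalT η t ∣
  evalQF ρ η (teq t u)   = evalT η t ≡ evalT η u
  evalQF ρ η (tsub t u)  = evalT η t ⊆ evalT η u
  evalQF ρ η (tsup t u)  = evalT η u ⊆ evalT η t
  evalQF ρ η (conn t)    = Connected (graph G) (λ v → v ∈ evalT η t)
  evalQF ρ η (acy t)     = Acyclic (graph G) (λ v → v ∈ evalT η t)
  evalQF ρ η (neg φ)     = ¬ evalQF ρ η φ
  evalQF ρ η (and φ ψ)   = evalQF ρ η φ × evalQF ρ η ψ
  evalQF ρ η (or φ ψ)    = evalQF ρ η φ ⊎ evalQF ρ η ψ

  eval : {a b : ℕ} → (Fin a → V) → (Fin b → Subset (n (graph G))) → Formula σ a b → Set
  eval ρ η (qf φ)    = evalQF ρ η φ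
  eval ρ η (and φ ψ) = eval ρ η φ × eval ρ η ψ
  eval ρ η (or φ ψ)  = eval ρ η φ ⊎ eval ρ η ψ
  eval ρ η (exV φ)   = Σ V λ x → eval (ext ρ x) η φ
  eval ρ η (exS φ)   = Σ (Subset (n (graph G))) λ X → eval ρ (ext η X) φ

_⊨_ : {σ : ℕ} → CGraph σ → Sentence σ → Set
G ⊨ φ = eval G (λ ()) (λ ()) φ

FVS : Graph → ℕ → Set
FVS G k = Σ (Subset (n G)) λ X → (∣ X ∣ ≤ k) × Acyclic G (λ v → v ∉ X)

IsInducedPath : (G : Graph) (m : ℕ) → (Fin m → Fin (n G)) → Set
IsInducedPath G m p =
  Injective _≡_ _≡_ p ×
  (∀ i j → Adj G (p i) (p j) ⇔ (suc (toℕ i) ≡ toℕ j ⊎ suc (toℕ j) ≡ toℕ i))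

LIP : Graph → ℕ → Set
LIP G k = Σ (Fin k → Fin (n G)) λ p → IsInducedPath G k p

record InducedSTPath (G : Graph) (s t : Fin (n G)) : Set where
  field
    len    : ℕ
    p      : Fin (suc len) → Fin (n G)
    start  : p zero ≡ s
    end    : p (Data.Fin.fromℕ len) ≡ t
    induced : IsInducedPath G (suc len) p

OnPath : {G : Graph} {s t : Fin (n G)} → InducedSTPath G s t → Fin (n G) → Set
OnPath π v = Σ (Fin (suc (InducedSTPath.len π))) λ i → InducedSTPath.p π i ≡ v

IDP : {k : ℕ} (G : Graph) → (s t : Fin k → Fin (n G)) → Set
IDP {k} G s t =
  Σ ((i : Fin k) → InducedSTPath G (s i) (t i)) λ π →
    ∀ i j → i ≢ j → ∀ u v → OnPath (π i) u → OnPath (π j) v →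
      -- vertices that are shared terminals of the pairs i and j are exempt
      ¬ SharedT i j u → ¬ SharedT i j v →
      (u ≢ v) × ¬ Adj G u v
  where
    SharedT : Fin k → Fin k → Fin (n G) → Set
    SharedT i j x = (x ≡ s i ⊎ x ≡ t i) × (x ≡ s j ⊎ x ≡ t j)

-- 4. H-Induced Topological Minor.
-- The subdivision of H in which the edge {a,c} (toℕ a < toℕ c) is replaced
-- by a path with ℓ a c internal vertices.
SubdivV : (H : Graph) → (Fin (n H) → Fin (n H) → ℕ) → Set
SubdivV H ℓ = Fin (n H) ⊎
  Σ (Fin (n H)) λ a → Σ (Fin (n H)) λ c →
    (toℕ a < toℕ c) × Adj H a c × Fin (ℓ a c)

SubdivAdj : (H : Graph) (ℓ : Fin (n H) → Fin (n H) → ℕ) → SubdivV H ℓ → SubdivV H ℓ → Set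
SubdivAdj H ℓ (Data.Sum.inj₁ x) (Data.Sum.inj₁ y) =
  (toℕ x < toℕ y × Adj H x y × ℓ x y ≡ 0) ⊎ (toℕ y < toℕ x × Adj H y x × ℓ y x ≡ 0)
SubdivAdj H ℓ (Data.Sum.inj₁ x) (Data.Sum.inj₂ (a , c , _ , _ , i)) =
  (x ≡ a × toℕ i ≡ 0) ⊎ (x ≡ c × suc (toℕ i) ≡ ℓ a c)
SubdivAdj H ℓ (Data.Sum.inj₂ (a , c , _ , _ , i)) (Data.Sum.inj₁ x) =
  (x ≡ a × toℕ i ≡ 0) ⊎ (x ≡ c × suc (toℕ i) ≡ ℓ a c)
SubdivAdj H ℓ (Data.Sum.inj₂ (a , c , _ , _ , i)) (Data.Sum.inj₂ (a' , c' , _ , _ , j)) =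
  a ≡ a' × c ≡ c' × (suc (toℕ i) ≡ toℕ j ⊎ suc (toℕ j) ≡ toℕ i)

InducedTopMinor : Graph → Graph → Set
InducedTopMinor H G =
  Σ (Fin (n H) → Fin (n H) → ℕ) λ ℓ →
  Σ (SubdivV H ℓ → Fin (n G)) λ ι →
    Injective _≡_ _≡_ ι × (∀ x y → Adj G (ι x) (ι y) ⇔ SubdivAdj H ℓ x y)

AcyclicColoring : Graph → ℕ → Set
AcyclicColoring G k =
  Σ (Fin (n G) → Fin k) λ col →
    (∀ u v → Adj G u v → col u ≢ col v) ×
    (∀ i j → i ≢ j → Acyclic G (λ v → col v ≡ i ⊎ col v ≡ j))

{-# OPTIONS --safe #-}

-- Each problem is "there are vertices and vertex sets passing a quantifier-free
-- check".  Acyclic colouring: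
-- colour classes that cover V, are independent, and any two of which induce a
-- forest.  Induced disjoint paths: connected sets X_i ⊇ P_i whose parts outside
-- the shared terminals are pairwise apart (disjoint, with no edge between them;
-- A is apart from B iff A ∩ (B ∪ N¹₁(B)) = ∅).  Induced subdivision of H: branch
-- vertices x_a and, for each edge ac of H, a connected set S_ac ∋ x_a, x_c whose
-- interior is apart from the other branch vertices and the other interiors.
-- The step back from connected sets to paths: a connected set contains an
-- induced path between any two of its vertices, obtained from a walk by cutting
-- out repeated vertices and chords until none is left.
module Submission where

open import Defs hiding (sym)
open import Data.Nat as ℕ using (ℕ; zero; suc; _+_; _∸_; _*_; _≤_; _<_; _≤?_; _<?_; z≤n; s≤s)
import Data.Nat.Properties as ℕₚ
open import Data.Fin using (Fin; zero; suc; toℕ; fromℕ; fromℕ<; inject₁; _↑ˡ_; _↑ʳ_; combine; remQuot; _≟_)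
import Data.Fin.Properties as Finₚ
open import Data.Fin.Subset using (Subset; ⁅_⁆; _∩_; _∪_; _─_; _-_; ∣_∣; _⊆_; _∈_; _∉_; ⊥; Nonempty)
open import Data.Fin.Subset.Properties
  using (x∈p∩q⁺; x∈p∩q⁻; x∈p∪q⁺; x∈p∪q⁻; x∈p∧x∉q⇒x∈p─q; p─q⊆p; ∉⊥; x∉p⇒x∈∁p; x∈∁p⇒x∉p;
         x∈p⇒∣p-x∣<∣p∣; x∈p∧x≢y⇒x∈p-y; x∈⁅x⁆; x∈⁅y⁆⇒x≡y; ∣⁅x⁆∣≡1)
open import Data.Vec using (_∷_; here; there; lookup; tabulate)
open import Data.Vec.Properties using (lookup∘tabulate; []=⇒lookup; lookup⇒[]=)
open import Data.List using (allFin)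
open import Data.List.Relation.Unary.Any using (satisfied)
open import Data.List.Relation.Unary.Any.Properties using (any⁺; any⁻)
open import Data.List.Membership.Propositional using (lose)
open import Data.List.Membership.Propositional.Properties using (∈-allFin)
open import Data.Bool using (Bool; true; false; T; _∧_; not)
open import Data.Bool.Properties as Boolₚ using (T-≡; T-∧; T-∨)
open import Data.Product using (Σ; ∃; _×_; _,_; proj₁; proj₂; uncurry)
open import Data.Product.Function.Dependent.Propositional using () renaming (congˡ to Σ-congˡ)
open import Data.Sum as Sum using (_⊎_; inj₁; inj₂; [_,_])
import Data.Sum.Properties as Sumₚ
open import Data.Unit using (⊤; tt)
open import Relation.Nullary using (¬_; ⌊_⌋; Dec; yes; no; contradiction)
open import Relation.Nullary.Decidable
  using (_×-dec_; _⊎-dec_; decidable-stable; toWitness; fromWitness; toWitnessFalse; fromWitnessFalse)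
open import Relation.Binary.Definitions using (Tri; tri<; tri≈; tri>)
open import Relation.Binary.PropositionalEquality
  using (_≡_; _≢_; refl; sym; trans; cong; cong₂; subst; subst₂)
open import Axiom.UniquenessOfIdentityProofs using (module Decidable⇒UIP)
open import Function using (id; _∘_; _⇔_; mk⇔; Equivalence; case_of_)
open import Function.Definitions using (Injective)
open import Function.Construct.Composition using (_⇔-∘_)
open import Function.Related.Propositional using (equivalence)

private
  ∃-cong : {A : Set} {P Q : A → Set} → (∀ {x} → P x ⇔ Q x) → ∃ P ⇔ ∃ Q
  ∃-cong = Σ-congˡ {k = equivalence}
  to : ∀ {A B : Set} → A ⇔ B → A → B
  to = Equivalence.to
  from : ∀ {A B : Set} → A ⇔ B → B → A
  from = Equivalence.from

∈-tabulate⇔ : ∀ {k} {f : Fin k → Bool} {x} → x ∈ tabulate f ⇔ T (f x)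
∈-tabulate⇔ {f = f} {x} = mk⇔
  (λ x∈ → from T-≡ (trans (sym (lookup∘tabulate f x)) ([]=⇒lookup x∈)))
  (λ fx → lookup⇒[]= x (tabulate f) (trans (lookup∘tabulate f x) (to T-≡ fx)))

∈⇔lookup : ∀ {k} {p : Subset k} {x} → x ∈ p ⇔ T (lookup p x)
∈⇔lookup {p = p} {x} = mk⇔ (from T-≡ ∘ []=⇒lookup) (lookup⇒[]= x p ∘ to T-≡)

subsetOf : ∀ {k} {P : Fin k → Set} → (∀ x → Dec (P x)) → Subset k
subsetOf P? = tabulate (λ x → ⌊ P? x ⌋)

∈-subsetOf⇔ : ∀ {k} {P : Fin k → Set} {P? : ∀ x → Dec (P x)} {x} → x ∈ subsetOf P? ⇔ P x
∈-subsetOf⇔ = mk⇔ (toWitness ∘ to ∈-tabulate⇔) (from ∈-tabulate⇔ ∘ fromWitness)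

x∈p─q⇒x∉q : ∀ {k} {p q : Subset k} {x} → x ∈ p ─ q → x ∉ q
x∈p─q⇒x∉q {p = true ∷ p} {false ∷ q} here ()
x∈p─q⇒x∉q {p = _ ∷ p} {_ ∷ q} (there x∈) (there x∈q) = x∈p─q⇒x∉q x∈ x∈q

x∈p⇒1≤∣p∣ : ∀ {k} {p : Subset k} {x} → x ∈ p → 1 ≤ ∣ p ∣
x∈p⇒1≤∣p∣ x∈p = ℕₚ.≤-trans (s≤s z≤n) (x∈p⇒∣p-x∣<∣p∣ x∈p)

1≤∣p∣⇒Nonempty : ∀ {k} {p : Subset k} → 1 ≤ ∣ p ∣ → Nonempty p
1≤∣p∣⇒Nonempty {p = true ∷ p} _ = zero , here
1≤∣p∣⇒Nonempty {p = false ∷ p} 1≤∣p∣ with 1≤∣p∣⇒Nonempty 1≤∣p∣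
... | x , x∈p = suc x , there x∈p

∣p∣≡1⇒x≡y : ∀ {k} {p : Subset k} {x y} → ∣ p ∣ ≡ 1 → x ∈ p → y ∈ p → x ≡ y
∣p∣≡1⇒x≡y {p = p} {x} {y} ∣p∣≡1 x∈p y∈p with x ≟ y
... | yes x≡y = x≡y
... | no x≢y = contradiction (x∈p⇒1≤∣p∣ (x∈p∧x≢y⇒x∈p-y y∈p (x≢y ∘ sym)))
  (ℕₚ.<⇒≱ (subst (∣ p - x ∣ <_) ∣p∣≡1 (x∈p⇒∣p-x∣<∣p∣ x∈p)))

module _ (G : Graph) where

  private
    variable
      u v : Fin (n G)
      S S′ : Fin (n G) → Set

  Adj-sym : Adj G u v → Adj G v u
  Adj-sym {u} {v} uv = trans (Graph.sym G v u) uv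

  Adj-irrefl : ¬ Adj G v v
  Adj-irrefl {v} vv with trans (sym vv) (irrefl G v)
  ... | ()

  reach-1⇔ : T (reach G 1 u v) ⇔ (u ≡ v ⊎ Adj G u v)
  reach-1⇔ {u} {v} = mk⇔ ⇒ ⇐
    where
    via : Fin (n G) → Bool
    via w = ⌊ u ≟ w ⌋ ∧ E G w v
    ⇒ : T (reach G 1 u v) → u ≡ v ⊎ Adj G u v
    ⇒ r with to T-∨ r
    ... | inj₁ u≡v = inj₁ (toWitness {a? = u ≟ v} u≡v)
    ... | inj₂ via-w with satisfied (any⁻ via (allFin (n G)) via-w)
    ... | w , uw∧wv with to T-∧ uw∧wv
    ... | uw , wv with toWitness {a? = u ≟ w} uw
    ... | refl = inj₂ (to T-≡ wv)
    ⇐ : u ≡ v ⊎ Adj G u v → T (reach G 1 u v)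
    ⇐ (inj₁ u≡v) = from (T-∨ {⌊ u ≟ v ⌋}) (inj₁ (fromWitness {a? = u ≟ v} u≡v))
    ⇐ (inj₂ uv) = from (T-∨ {⌊ u ≟ v ⌋}) (inj₂ (any⁺ via
      (lose (∈-allFin u) (from (T-∧ {⌊ u ≟ u ⌋}) (fromWitness {a? = u ≟ u} refl , from T-≡ uv)))))

  ∈N¹⇔ : {U : Subset (n G)} → v ∈ Nbh G 1 1 U ⇔ ∃ λ u → u ∈ U × Adj G u v
  ∈N¹⇔ {v} {U} = mk⇔ ⇒ ⇐
    where
    ⇒ : v ∈ Nbh G 1 1 U → ∃ λ u → u ∈ U × Adj G u v
    ⇒ v∈ with 1≤∣p∣⇒Nonempty (ℕₚ.≤ᵇ⇒≤ 1 _ (to ∈-tabulate⇔ v∈))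
    ... | u , u∈ with to (T-∧ {not ⌊ u ≟ v ⌋}) (to ∈-tabulate⇔ u∈)
    ... | u≢v , r∧u∈U with to (T-∧ {reach G 1 u v}) r∧u∈U
    ... | r , u∈U with to reach-1⇔ r
    ... | inj₁ u≡v = contradiction u≡v (toWitnessFalse {a? = u ≟ v} u≢v)
    ... | inj₂ uv = u , from ∈⇔lookup u∈U , uv
    ⇐ : (∃ λ u → u ∈ U × Adj G u v) → v ∈ Nbh G 1 1 U
    ⇐ (u , u∈U , uv) = from ∈-tabulate⇔ (ℕₚ.≤⇒≤ᵇ (x∈p⇒1≤∣p∣ {x = u} (from ∈-tabulate⇔
        (from (T-∧ {not ⌊ u ≟ v ⌋}) (fromWitnessFalse {a? = u ≟ v} (λ { refl → Adj-irrefl uv }) ,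
          from (T-∧ {reach G 1 u v}) (from reach-1⇔ (inj₂ uv) , to ∈⇔lookup u∈U))))))

  Acyclic-anti : (∀ {v} → S v → S′ v) → Acyclic G S′ → Acyclic G S
  Acyclic-anti S⊆S′ acyclic C = acyclic (record
    { m = m ; m≥3 = m≥3 ; f = f ; inj = inj ; inS = S⊆S′ ∘ inS ; step = step })
    where open CycleIn C

  cycle⇒edge : CycleIn G S → ∃ λ u → ∃ λ v → S u × S v × Adj G u v
  cycle⇒edge record { m≥3 = s≤s (s≤s _) ; f = f ; inS = inS ; step = step } =
    f zero , f (suc zero) , inS zero , inS (suc zero) , step zero (suc zero) (inj₁ refl)

  Connected-resp : (∀ {v} → S v ⇔ S′ v) → Connected G S′ → Connected G S
  Connected-resp S⇔S′ connected u v u∈ v∈ = record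
    { len = len ; w = w ; start = start ; end = end ; inS = from S⇔S′ ∘ inS ; step = step }
    where open WalkIn (connected u v (to S⇔S′ u∈) (to S⇔S′ v∈))

-- Walks and induced paths

-- ℕ-indexed walks (the values of w beyond L are irrelevant): splicing a walk
-- is index arithmetic on ℕ rather than on Fin.
record Walk (G : Graph) (S : Fin (n G) → Set) (u v : Fin (n G)) : Set where
  field
    L   : ℕ
    w   : ℕ → Fin (n G)
    w0  : w 0 ≡ u
    wL  : w L ≡ v
    inS : ∀ k → k ≤ L → S (w k)
    st  : ∀ k → k < L → Adj G (w k) (w (suc k))

module _ {G : Graph} {S : Fin (n G) → Set} {u v : Fin (n G)} where

  Chordless : Walk G S u v → Set
  Chordless W = (∀ i j → i < j → j ≤ L → w i ≢ w j)
              × (∀ i j → suc i < j → j ≤ L → ¬ Adj G (w i) (w j))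
    where open Walk W

  -- Drops w (i+1), …, w (i+d); the last two hypotheses let w i be followed directly by w (i+d+1).
  skip : (W : Walk G S u v) (i d : ℕ) → let open Walk W in
         0 < d → i + d ≤ L → (i + d ≡ L → w i ≡ v) → (i + d < L → Adj G (w i) (w (suc (i + d)))) →
         Σ (Walk G S u v) λ W′ → Walk.L W′ < L
  skip W i d 0<d i+d≤L last jump =
    record { L = L ∸ d ; w = w′ ; w0 = w′0 ; wL = w′L ; inS = inS′ ; st = st′ } , ℕₚ.∸-monoʳ-< 0<d d≤L
    where
    open Walk W
    d≤L : d ≤ L
    d≤L = ℕₚ.m+n≤o⇒n≤o i i+d≤L
    k+d≤L : ∀ {k} → k ≤ L ∸ d → k + d ≤ L
    k+d≤L {k} k≤ = subst (k + d ≤_) (ℕₚ.m∸n+n≡m d≤L) (ℕₚ.+-monoˡ-≤ d k≤)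
    w′ : ℕ → Fin (n G)
    w′ k with k ≤? i
    ... | yes _ = w k
    ... | no _ = w (k + d)
    w′-≤ : ∀ {k} → k ≤ i → w′ k ≡ w k
    w′-≤ {k} k≤i with k ≤? i
    ... | yes _ = refl
    ... | no k≰i = contradiction k≤i k≰i
    w′0 : w′ 0 ≡ u
    w′0 = trans (w′-≤ z≤n) w0
    w′L : w′ (L ∸ d) ≡ v
    w′L with L ∸ d ≤? i
    ... | no _ = trans (cong w (ℕₚ.m∸n+n≡m d≤L)) wL
    ... | yes L∸d≤i = subst (λ k → w k ≡ v) (trans (sym (ℕₚ.m+n∸n≡m i d)) (cong (_∸ d) i+d≡L)) (last i+d≡L)
      where
      i+d≡L : i + d ≡ L
      i+d≡L = ℕₚ.≤-antisym i+d≤L (subst (_≤ i + d) (ℕₚ.m∸n+n≡m d≤L) (ℕₚ.+-monoˡ-≤ d L∸d≤i))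
    inS′ : ∀ k → k ≤ L ∸ d → S (w′ k)
    inS′ k k≤ with k ≤? i
    ... | yes k≤i = inS k (ℕₚ.≤-trans k≤i (ℕₚ.m+n≤o⇒m≤o i i+d≤L))
    ... | no _ = inS (k + d) (k+d≤L k≤)
    st′ : ∀ k → k < L ∸ d → Adj G (w′ k) (w′ (suc k))
    st′ k k< with k ≤? i | suc k ≤? i
    ... | yes _ | yes k<i = st k (ℕₚ.<-≤-trans k<i (ℕₚ.m+n≤o⇒m≤o i i+d≤L))
    ... | yes k≤i | no k≮i =
      subst (λ z → Adj G (w z) (w (suc (z + d)))) i≡k (jump (subst (λ z → z + d < L) (sym i≡k) (k+d≤L k<)))
      where
      i≡k : i ≡ k
      i≡k = ℕₚ.≤-antisym (ℕₚ.≮⇒≥ k≮i) k≤i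
    ... | no k≰i | yes k<i = contradiction (ℕₚ.<⇒≤ k<i) k≰i
    ... | no _ | no _ = st (k + d) (k+d≤L k<)

  Shortcut : Walk G S u v → Set
  Shortcut W = ∃ λ j → j < suc L × ∃ λ i → i < j × (w i ≡ w j ⊎ (suc i < j × Adj G (w i) (w j)))
    where open Walk W

  shortcut? : (W : Walk G S u v) → Dec (Shortcut W)
  shortcut? W = ℕₚ.anyUpTo? (λ j → ℕₚ.anyUpTo? (λ i →
    (w i ≟ w j) ⊎-dec ((suc i <? j) ×-dec (E G (w i) (w j) Boolₚ.≟ true))) j) (suc L)
    where open Walk W

  ¬shortcut⇒chordless : (W : Walk G S u v) → ¬ Shortcut W → Chordless W
  ¬shortcut⇒chordless W ¬sc =
    (λ i j i<j j≤L wi≡wj → ¬sc (j , s≤s j≤L , i , i<j , inj₁ wi≡wj)) ,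
    (λ i j 1+i<j j≤L wi~wj → ¬sc (j , s≤s j≤L , i , ℕₚ.<-trans (ℕₚ.n<1+n i) 1+i<j , inj₂ (1+i<j , wi~wj)))

  shortcut⇒shorter : (W : Walk G S u v) → Shortcut W → Σ (Walk G S u v) λ W′ → Walk.L W′ < Walk.L W
  shortcut⇒shorter W (j , s≤s j≤L , i , i<j , inj₁ wi≡wj) =
    skip W i d (ℕₚ.m<n⇒0<n∸m i<j) i+d≤L last jump
    where
    open Walk W
    d : ℕ
    d = j ∸ i
    i+d≡j : i + d ≡ j
    i+d≡j = ℕₚ.m+[n∸m]≡n (ℕₚ.<⇒≤ i<j)
    i+d≤L : i + d ≤ L
    i+d≤L = subst (_≤ L) (sym i+d≡j) j≤L
    last : i + d ≡ L → w i ≡ v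
    last i+d≡L = trans wi≡wj (trans (cong w (trans (sym i+d≡j) i+d≡L)) wL)
    jump : i + d < L → Adj G (w i) (w (suc (i + d)))
    jump i+d<L = subst₂ (λ x y → Adj G x (w (suc y))) (sym wi≡wj) (sym i+d≡j) (st j (subst (_< L) i+d≡j i+d<L))
  shortcut⇒shorter W (j , s≤s j≤L , i , _ , inj₂ (1+i<j , wi~wj)) =
    skip W i d (ℕₚ.m<n⇒0<n∸m 1+i<j) i+d≤L last jump
    where
    open Walk W
    d : ℕ
    d = j ∸ suc i
    1+i+d≡j : suc (i + d) ≡ j
    1+i+d≡j = ℕₚ.m+[n∸m]≡n (ℕₚ.<⇒≤ 1+i<j)
    i+d≤L : i + d ≤ L
    i+d≤L = ℕₚ.<⇒≤ (subst (_≤ L) (sym 1+i+d≡j) j≤L)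
    last : i + d ≡ L → w i ≡ v
    last i+d≡L = contradiction (subst (_≤ L) (sym 1+i+d≡j) j≤L) (ℕₚ.<-irrefl i+d≡L)
    jump : i + d < L → Adj G (w i) (w (suc (i + d)))
    jump _ = subst (λ x → Adj G (w i) (w x)) (sym 1+i+d≡j) wi~wj

  chordless : Walk G S u v → Σ (Walk G S u v) Chordless
  chordless W = go (suc (Walk.L W)) W ℕₚ.≤-refl
    where
    go : ∀ fuel (W : Walk G S u v) → Walk.L W < fuel → Σ (Walk G S u v) Chordless
    go (suc fuel) W L<fuel with shortcut? W
    ... | no ¬sc = W , ¬shortcut⇒chordless W ¬sc
    ... | yes sc with shortcut⇒shorter W sc
    ... | W′ , L′<L = go fuel W′ (ℕₚ.<-≤-trans L′<L (ℕₚ.≤-pred L<fuel))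

module _ {G : Graph} where

  private
    V : Set
    V = Fin (n G)
    variable
      S S′ : V → Set
      u v : V

  extend : ∀ {L} → V → (Fin (suc L) → V) → ℕ → V
  extend {L} default f k with k <? suc L
  ... | yes k<1+L = f (fromℕ< k<1+L)
  ... | no _ = default

  extend-< : ∀ {L} default (f : Fin (suc L) → V) k (k<1+L : k < suc L) → extend default f k ≡ f (fromℕ< k<1+L)
  extend-< {L} default f k k<1+L with k <? suc L
  ... | yes _ = refl
  ... | no k≮1+L = contradiction k<1+L k≮1+L

  fromWalkIn : WalkIn G S u v → Walk G S u v
  fromWalkIn {S} {u} {v} W = record
    { L = len ; w = extend u w
    ; w0 = trans (extend-< u w 0 (s≤s z≤n)) start
    ; wL = trans (extend-< u w len (ℕₚ.n<1+n len)) (trans (cong w (sym (Finₚ.fromℕ-def len))) end)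
    ; inS = λ k k≤ → subst S (sym (extend-< u w k (s≤s k≤))) (inS (fromℕ< (s≤s k≤)))
    ; st = λ k k< → subst₂ (Adj G) (sym (extend-< u w k (ℕₚ.m≤n⇒m≤1+n k<)))
                                   (sym (extend-< u w (suc k) (s≤s k<)))
        (step (fromℕ< (ℕₚ.m≤n⇒m≤1+n k<)) (fromℕ< (s≤s k<))
              (trans (cong suc (Finₚ.toℕ-fromℕ< (ℕₚ.m≤n⇒m≤1+n k<))) (sym (Finₚ.toℕ-fromℕ< (s≤s k<))))) }
    where open WalkIn W

  toWalkIn : Walk G S u v → WalkIn G S u v
  toWalkIn {S} {u} {v} W = record
    { len = L ; w = w ∘ toℕ ; start = w0
    ; end = subst (λ k → w k ≡ v) (sym (Finₚ.toℕ-fromℕ L)) wL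
    ; inS = λ i → inS (toℕ i) (ℕₚ.≤-pred (Finₚ.toℕ<n i))
    ; step = λ i j 1+i≡j → subst (λ k → Adj G (w (toℕ i)) (w k)) 1+i≡j
        (st (toℕ i) (subst (_≤ L) (sym 1+i≡j) (ℕₚ.≤-pred (Finₚ.toℕ<n j)))) }
    where open Walk W

  chordless⇒inducedPath : (W : Walk G S u v) → Chordless W →
                          Σ (InducedSTPath G u v) λ π → ∀ x → OnPath π x → S x
  chordless⇒inducedPath {S} {u} {v} W (distinct , noChord) = record
    { len = L ; p = path ; start = w0 ; end = subst (λ k → w k ≡ v) (sym (Finₚ.toℕ-fromℕ L)) wL
    ; induced = path-injective , path-adj } , λ { x (i , refl) → inS (toℕ i) (toℕ≤L i) }
    where
    open Walk W
    path : Fin (suc L) → V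
    path = w ∘ toℕ
    toℕ≤L : (i : Fin (suc L)) → toℕ i ≤ L
    toℕ≤L i = ℕₚ.≤-pred (Finₚ.toℕ<n i)
    path-injective : Injective _≡_ _≡_ path
    path-injective {i} {j} pi≡pj with ℕₚ.<-cmp (toℕ i) (toℕ j)
    ... | tri< i<j _ _ = contradiction pi≡pj (distinct _ _ i<j (toℕ≤L j))
    ... | tri≈ _ i≡j _ = Finₚ.toℕ-injective i≡j
    ... | tri> _ _ j<i = contradiction (sym pi≡pj) (distinct _ _ j<i (toℕ≤L i))
    consecutive⇒adj : ∀ i j → suc (toℕ i) ≡ toℕ j → Adj G (path i) (path j)
    consecutive⇒adj i j 1+i≡j =
      subst (λ k → Adj G (path i) (w k)) 1+i≡j (st (toℕ i) (subst (_≤ L) (sym 1+i≡j) (toℕ≤L j)))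
    adj⇒consecutive : ∀ i j → toℕ i < toℕ j → Adj G (path i) (path j) → suc (toℕ i) ≡ toℕ j
    adj⇒consecutive i j i<j pi~pj with suc (toℕ i) ℕ.≟ toℕ j
    ... | yes 1+i≡j = 1+i≡j
    ... | no 1+i≢j = contradiction pi~pj (noChord _ _ (ℕₚ.≤∧≢⇒< i<j 1+i≢j) (toℕ≤L j))
    path-adj : ∀ i j → Adj G (path i) (path j) ⇔ (suc (toℕ i) ≡ toℕ j ⊎ suc (toℕ j) ≡ toℕ i)
    path-adj i j = mk⇔ ⇒ [ consecutive⇒adj i j , Adj-sym G ∘ consecutive⇒adj j i ]
      where
      ⇒ : Adj G (path i) (path j) → suc (toℕ i) ≡ toℕ j ⊎ suc (toℕ j) ≡ toℕ i
      ⇒ pi~pj with ℕₚ.<-cmp (toℕ i) (toℕ j)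
      ... | tri< i<j _ _ = inj₁ (adj⇒consecutive i j i<j pi~pj)
      ... | tri≈ _ i≡j _ =
        contradiction (subst (λ k → Adj G (path i) (path k)) (sym (Finₚ.toℕ-injective i≡j)) pi~pj) (Adj-irrefl G)
      ... | tri> _ _ j<i = inj₂ (adj⇒consecutive j i j<i (Adj-sym G pi~pj))

  walk⇒inducedPath : WalkIn G S u v → Σ (InducedSTPath G u v) λ π → ∀ x → OnPath π x → S x
  walk⇒inducedPath W = uncurry chordless⇒inducedPath (chordless (fromWalkIn W))

  Range : Walk G S u v → V → Set
  Range W x = ∃ λ k → k < suc (Walk.L W) × Walk.w W k ≡ x

  range-connected : (W : Walk G S u v) → Connected G (Range W)
  range-connected W ._ ._ (a , s≤s a≤L , refl) (b , s≤s b≤L , refl) with a ≤? b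
  ... | yes a≤b = toWalkIn (record
    { L = b ∸ a ; w = λ k → w (a + k) ; w0 = cong w (ℕₚ.+-identityʳ a)
    ; wL = cong w (ℕₚ.m+[n∸m]≡n a≤b)
    ; inS = λ k k≤ → a + k , s≤s (ℕₚ.≤-trans (a+k≤b k≤) b≤L) , refl
    ; st = λ k k< → subst (λ j → Adj G (w (a + k)) (w j)) (sym (ℕₚ.+-suc a k))
        (st (a + k) (ℕₚ.≤-trans (subst (_≤ b) (ℕₚ.+-suc a k) (a+k≤b k<)) b≤L)) })
    where
    open Walk W
    a+k≤b : ∀ {k} → k ≤ b ∸ a → a + k ≤ b
    a+k≤b {k} k≤ = subst (a + k ≤_) (ℕₚ.m+[n∸m]≡n a≤b) (ℕₚ.+-monoʳ-≤ a k≤)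
  ... | no a≰b = toWalkIn (record
    { L = a ∸ b ; w = λ k → w (a ∸ k) ; w0 = refl
    ; wL = cong w (ℕₚ.m∸[m∸n]≡n b≤a)
    ; inS = λ k _ → a ∸ k , s≤s (ℕₚ.≤-trans (ℕₚ.m∸n≤m a k) a≤L) , refl
    ; st = λ k k< → step-back k (ℕₚ.<-≤-trans k< (ℕₚ.m∸n≤m a b)) })
    where
    open Walk W
    b≤a : b ≤ a
    b≤a = ℕₚ.<⇒≤ (ℕₚ.≰⇒> a≰b)
    step-back : ∀ k → k < a → Adj G (w (a ∸ k)) (w (a ∸ suc k))
    step-back k k<a = subst (λ j → Adj G (w j) (w (a ∸ suc k))) (sym a∸k≡1+a∸1+k)
      (Adj-sym G (st (a ∸ suc k) (ℕₚ.<-≤-trans (subst (_≤ a) a∸k≡1+a∸1+k (ℕₚ.m∸n≤m a k)) a≤L)))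
      where
      a∸k≡1+a∸1+k : a ∸ k ≡ suc (a ∸ suc k)
      a∸k≡1+a∸1+k = ℕₚ.+-∸-assoc 1 k<a

  Range⊆S : (W : Walk G S u v) → ∀ {x} → Range W x → S x
  Range⊆S {S} W (k , s≤s k≤L , refl) = Walk.inS W k k≤L

  start∈Range : (W : Walk G S u v) → Range W u
  start∈Range W = 0 , s≤s z≤n , Walk.w0 W

  end∈Range : (W : Walk G S u v) → Range W v
  end∈Range W = Walk.L W , ℕₚ.≤-refl , Walk.wL W

  rangeSet : Walk G S u v → Subset (n G)
  rangeSet W = subsetOf (λ x → ℕₚ.anyUpTo? (λ k → Walk.w W k ≟ x) (suc (Walk.L W)))

  rangeSet-connected : (W : Walk G S u v) → Connected G (_∈ rangeSet W)
  rangeSet-connected W = Connected-resp G ∈-subsetOf⇔ (range-connected W)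

  pathWalk : (π : InducedSTPath G u v) → Walk G (OnPath π) u v
  pathWalk π = fromWalkIn (record
    { len = len ; w = InducedSTPath.p π ; start = start ; end = end ; inS = λ i → i , refl
    ; step = λ i j 1+i≡j → from (proj₂ induced i j) (inj₁ 1+i≡j) })
    where open InducedSTPath π

Consecutiveℕ : ℕ → ℕ → Set
Consecutiveℕ i j = suc i ≡ j ⊎ suc j ≡ i

Consecutive : ∀ {k} → Fin k → Fin k → Set
Consecutive i j = Consecutiveℕ (toℕ i) (toℕ j)

consecutive? : ∀ {k} (i j : Fin k) → Dec (Consecutive i j)
consecutive? i j = (suc (toℕ i) ℕ.≟ toℕ j) ⊎-dec (suc (toℕ j) ℕ.≟ toℕ i)

Consecutiveℕ-suc : ∀ {i j} → Consecutiveℕ (suc i) (suc j) ⇔ Consecutiveℕ i j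
Consecutiveℕ-suc = mk⇔ (Sum.map ℕₚ.suc-injective ℕₚ.suc-injective) (Sum.map (cong suc) (cong suc))

Consecutiveℕ-0-suc : ∀ {j} → Consecutiveℕ 0 (suc j) ⇔ j ≡ 0
Consecutiveℕ-0-suc = mk⇔ [ sym ∘ ℕₚ.suc-injective , (λ ()) ] (λ { refl → inj₁ refl })

Consecutiveℕ-> : ∀ {i j} → j < i → Consecutiveℕ i j ⇔ suc j ≡ i
Consecutiveℕ-> j<i = mk⇔ [ (λ { refl → contradiction j<i (ℕₚ.<⇒≯ (ℕₚ.n<1+n _)) }) , id ] inj₂

inner : ∀ {ℓ} → Fin ℓ → Fin (2 + ℓ)
inner i = suc (inject₁ i)

last : ∀ ℓ → Fin (2 + ℓ)
last ℓ = fromℕ (suc ℓ)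

module InducedPath⁺ {G : Graph} {ℓ : ℕ} {q : Fin (2 + ℓ) → Fin (n G)}
                    (induced : IsInducedPath G (2 + ℓ) q) where

  private
    adj⇔ : ∀ i j → Adj G (q i) (q j) ⇔ Consecutiveℕ (toℕ i) (toℕ j)
    adj⇔ = proj₂ induced

  inner-injective : ∀ {i j} → q (inner i) ≡ q (inner j) → i ≡ j
  inner-injective = Finₚ.inject₁-injective ∘ Finₚ.suc-injective ∘ proj₁ induced

  inner≢first : ∀ i → q (inner i) ≢ q zero
  inner≢first i qi≡q0 with proj₁ induced qi≡q0
  ... | ()

  inner≢last : ∀ i → q (inner i) ≢ q (last ℓ)
  inner≢last i qi≡qL = Finₚ.fromℕ≢inject₁ (sym (Finₚ.suc-injective (proj₁ induced qi≡qL)))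

  adj-inner⇔ : ∀ i j → Adj G (q (inner i)) (q (inner j)) ⇔ Consecutive i j
  adj-inner⇔ i j = subst₂ (λ i′ j′ → Adj G (q (inner i)) (q (inner j)) ⇔ Consecutiveℕ i′ j′)
                          (Finₚ.toℕ-inject₁ i) (Finₚ.toℕ-inject₁ j)
                          (Consecutiveℕ-suc ⇔-∘ adj⇔ (inner i) (inner j))

  adj-first-inner⇔ : ∀ i → Adj G (q zero) (q (inner i)) ⇔ toℕ i ≡ 0
  adj-first-inner⇔ i = subst (λ i′ → Adj G (q zero) (q (inner i)) ⇔ i′ ≡ 0) (Finₚ.toℕ-inject₁ i)
                             (Consecutiveℕ-0-suc ⇔-∘ adj⇔ zero (inner i))

  adj-last-inner⇔ : ∀ i → Adj G (q (last ℓ)) (q (inner i)) ⇔ suc (toℕ i) ≡ ℓ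
  adj-last-inner⇔ i = Consecutiveℕ-> (Finₚ.toℕ<n i)
    ⇔-∘ subst₂ (λ ℓ′ i′ → Adj G (q (last ℓ)) (q (inner i)) ⇔ Consecutiveℕ ℓ′ i′)
               (Finₚ.toℕ-fromℕ ℓ) (Finₚ.toℕ-inject₁ i)
               (Consecutiveℕ-suc ⇔-∘ adj⇔ (last ℓ) (inner i))

  adj-first-last⇔ : Adj G (q zero) (q (last ℓ)) ⇔ ℓ ≡ 0
  adj-first-last⇔ = subst (λ ℓ′ → Adj G (q zero) (q (last ℓ)) ⇔ ℓ′ ≡ 0) (Finₚ.toℕ-fromℕ ℓ)
                          (Consecutiveℕ-0-suc ⇔-∘ adj⇔ zero (last ℓ))

IsInducedPath-resp : (G : Graph) {m : ℕ} {p q : Fin m → Fin (n G)} → (∀ i → p i ≡ q i) →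
                     IsInducedPath G m p → IsInducedPath G m q
IsInducedPath-resp G p≗q (p-injective , p-adj) =
  (λ {i} {j} qi≡qj → p-injective (trans (p≗q i) (trans qi≡qj (sym (p≗q j))))) ,
  (λ i j → mk⇔ (to (p-adj i j) ∘ subst₂ (Adj G) (sym (p≗q i)) (sym (p≗q j)))
               (subst₂ (Adj G) (p≗q i) (p≗q j) ∘ from (p-adj i j)))

record Branch (G : Graph) : Set where
  field
    ℓ : ℕ
    path : Fin (2 + ℓ) → Fin (n G)

record IsBranch (G : Graph) (S : Fin (n G) → Set) (x y : Fin (n G)) (β : Branch G) : Set where
  field
    first   : Branch.path β zero ≡ x
    final   : Branch.path β (last (Branch.ℓ β)) ≡ y
    induced : IsInducedPath G (2 + Branch.ℓ β) (Branch.path β)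
    inside  : ∀ i → S (Branch.path β i)

connected⇒branch : (G : Graph) {S : Fin (n G) → Set} {x y : Fin (n G)} → x ≢ y →
                   Connected G S → S x → S y → Σ (Branch G) (IsBranch G S x y)
connected⇒branch G {S} x≢y connected x∈S y∈S with walk⇒inducedPath (connected _ _ x∈S y∈S)
... | record { len = zero ; start = start ; end = end } , _ = contradiction (trans (sym start) end) x≢y
... | record { len = suc ℓ ; p = p ; start = start ; end = end ; induced = induced } , on⊆S =
  record { ℓ = ℓ ; path = p } ,
  record { first = start ; final = end ; induced = induced ; inside = λ i → on⊆S (p i) (i , refl) }

-- Apartness and formula combinators

module _ (G : Graph) where

  NoEdge : Subset (n G) → Subset (n G) → Set
  NoEdge A B = ∀ {x y} → x ∈ A → y ∈ B → ¬ Adj G x y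

  Apart : Subset (n G) → Subset (n G) → Set
  Apart A B = ∀ {x y} → x ∈ A → y ∈ B → x ≢ y × ¬ Adj G x y

  ∩N¹⊆⊥⇔NoEdge : {A B : Subset (n G)} → A ∩ Nbh G 1 1 B ⊆ ⊥ ⇔ NoEdge A B
  ∩N¹⊆⊥⇔NoEdge {A} {B} = mk⇔ ⇒ ⇐
    where
    ⇒ : A ∩ Nbh G 1 1 B ⊆ ⊥ → NoEdge A B
    ⇒ A∩NB⊆⊥ {x} {y} x∈A y∈B xy =
      ∉⊥ (A∩NB⊆⊥ (x∈p∩q⁺ (x∈A , from (∈N¹⇔ G) (y , y∈B , Adj-sym G xy))))
    ⇐ : NoEdge A B → A ∩ Nbh G 1 1 B ⊆ ⊥
    ⇐ noEdge x∈A∩NB with x∈p∩q⁻ A _ x∈A∩NB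
    ... | x∈A , x∈NB with to (∈N¹⇔ G) x∈NB
    ... | y , y∈B , yx = contradiction (Adj-sym G yx) (noEdge x∈A y∈B)

  ∩[∪N¹]⊆⊥⇔Apart : {A B : Subset (n G)} → A ∩ (B ∪ Nbh G 1 1 B) ⊆ ⊥ ⇔ Apart A B
  ∩[∪N¹]⊆⊥⇔Apart {A} {B} = mk⇔ ⇒ ⇐
    where
    ⇒ : A ∩ (B ∪ Nbh G 1 1 B) ⊆ ⊥ → Apart A B
    ⇒ sep x∈A y∈B =
      (λ { refl → ∉⊥ (sep (x∈p∩q⁺ (x∈A , x∈p∪q⁺ (inj₁ y∈B)))) }) ,
      to ∩N¹⊆⊥⇔NoEdge (λ x∈A∩NB → let (x∈A , x∈NB) = x∈p∩q⁻ A _ x∈A∩NB in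
                                   sep (x∈p∩q⁺ (x∈A , x∈p∪q⁺ (inj₂ x∈NB)))) x∈A y∈B
    ⇐ : Apart A B → A ∩ (B ∪ Nbh G 1 1 B) ⊆ ⊥
    ⇐ apart x∈ with x∈p∩q⁻ A _ x∈
    ... | x∈A , x∈B∪NB with x∈p∪q⁻ B _ x∈B∪NB
    ... | inj₁ x∈B = contradiction refl (proj₁ (apart x∈A x∈B))
    ... | inj₂ x∈NB = from ∩N¹⊆⊥⇔NoEdge (λ x∈A y∈B → proj₂ (apart x∈A y∈B)) (x∈p∩q⁺ (x∈A , x∈NB))

module _ {σ a b : ℕ} where

  ⊤ᶠ : QF σ a b
  ⊤ᶠ = teq empty empty

  ⋀ : (m : ℕ) → (Fin m → QF σ a b) → QF σ a b
  ⋀ zero φ = ⊤ᶠ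
  ⋀ (suc m) φ = and (φ zero) (⋀ m (φ ∘ suc))

  ⋃ : (m : ℕ) → (Fin m → Term σ a b) → Term σ a b
  ⋃ zero t = empty
  ⋃ (suc m) t = t zero ∪ₜ ⋃ m (t ∘ suc)

  when : {A : Set} → Dec A → QF σ a b → QF σ a b
  when (yes _) φ = φ
  when (no _) φ = ⊤ᶠ

  unless : {A : Set} → Dec A → QF σ a b → QF σ a b
  unless (yes _) φ = ⊤ᶠ
  unless (no _) φ = φ

  exactlyWhen : {A : Set} → Dec A → QF σ a b → QF σ a b
  exactlyWhen (yes _) φ = φ
  exactlyWhen (no _) φ = neg φ

  N¹ : Term σ a b → Term σ a b
  N¹ = N 1 1 (s≤s z≤n) (s≤s z≤n)

  apartᶠ : Term σ a b → Term σ a b → QF σ a b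
  apartᶠ t u = tsub (t ∩ₜ (u ∪ₜ N¹ u)) empty

∃ᵛ* : ∀ {σ a b} (m : ℕ) → Formula σ (m + a) b → Formula σ a b
∃ᵛ* zero φ = φ
∃ᵛ* (suc m) φ = ∃ᵛ* m (exV φ)

∃ˢ* : ∀ {σ a b} (m : ℕ) → Formula σ a (m + b) → Formula σ a b
∃ˢ* zero φ = φ
∃ˢ* (suc m) φ = ∃ˢ* m (exS φ)

module _ {σ : ℕ} (G : CGraph σ) where

  private
    V : Set
    V = Fin (n (graph G))
    𝒫V : Set
    𝒫V = Subset (n (graph G))

  prepend : {A : Set} {c : ℕ} (m : ℕ) → (Fin m → A) → (Fin c → A) → Fin (m + c) → A
  prepend zero xs ρ = ρ
  prepend (suc m) xs ρ = ext G (prepend m (xs ∘ suc) ρ) (xs zero)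

  prepend-↑ˡ : {A : Set} {c : ℕ} (m : ℕ) (xs : Fin m → A) (ρ : Fin c → A) (i : Fin m) →
               prepend m xs ρ (i ↑ˡ c) ≡ xs i
  prepend-↑ˡ (suc m) xs ρ zero = refl
  prepend-↑ˡ (suc m) xs ρ (suc i) = prepend-↑ˡ m (xs ∘ suc) ρ i

  prepend-↑ʳ : {A : Set} {c : ℕ} (m : ℕ) (xs : Fin m → A) (ρ : Fin c → A) (j : Fin c) →
               prepend m xs ρ (m ↑ʳ j) ≡ ρ j
  prepend-↑ʳ zero xs ρ j = refl
  prepend-↑ʳ (suc m) xs ρ j = prepend-↑ʳ m (xs ∘ suc) ρ j

  module _ {a b : ℕ} (ρ : Fin a → V) (η : Fin b → 𝒫V) where

    ⋀⇔ : (m : ℕ) (φ : Fin m → QF σ a b) → evalQF G ρ η (⋀ m φ) ⇔ (∀ i → evalQF G ρ η (φ i))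
    ⋀⇔ zero φ = mk⇔ (λ _ ()) (λ _ → refl)
    ⋀⇔ (suc m) φ = mk⇔
      (λ { (φ₀ , φₛ) zero → φ₀ ; (φ₀ , φₛ) (suc i) → to (⋀⇔ m (φ ∘ suc)) φₛ i })
      (λ all → all zero , from (⋀⇔ m (φ ∘ suc)) (all ∘ suc))

    ∈⋃⇔ : (m : ℕ) (t : Fin m → Term σ a b) {x : V} → x ∈ evalT G η (⋃ m t) ⇔ ∃ λ i → x ∈ evalT G η (t i)
    ∈⋃⇔ zero t = mk⇔ (λ x∈⊥ → contradiction x∈⊥ ∉⊥) (λ ())
    ∈⋃⇔ (suc m) t = mk⇔
      (λ x∈ → [ (λ x∈t₀ → zero , x∈t₀) , (λ x∈tₛ → let (i , x∈tᵢ) = to (∈⋃⇔ m (t ∘ suc)) x∈tₛ in suc i , x∈tᵢ) ]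
                (x∈p∪q⁻ (evalT G η (t zero)) _ x∈))
      (λ { (zero , x∈t₀) → x∈p∪q⁺ (inj₁ x∈t₀)
         ; (suc i , x∈tᵢ) → x∈p∪q⁺ (inj₂ (from (∈⋃⇔ m (t ∘ suc)) (i , x∈tᵢ))) })

    when⇔ : {A : Set} (d : Dec A) {φ : QF σ a b} → evalQF G ρ η (when d φ) ⇔ (A → evalQF G ρ η φ)
    when⇔ (yes A) = mk⇔ (λ ⊨φ _ → ⊨φ) (λ ⊨φ → ⊨φ A)
    when⇔ (no ¬A) = mk⇔ (λ _ A → contradiction A ¬A) (λ _ → refl)

    unless⇔ : {A : Set} (d : Dec A) {φ : QF σ a b} → evalQF G ρ η (unless d φ) ⇔ (¬ A → evalQF G ρ η φ)
    unless⇔ (yes A) = mk⇔ (λ _ ¬A → contradiction A ¬A) (λ _ → refl)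
    unless⇔ (no ¬A) = mk⇔ (λ ⊨φ _ → ⊨φ) (λ ⊨φ → ⊨φ ¬A)

    exactlyWhen⇔ : {A : Set} (d : Dec A) {φ : QF σ a b} → evalQF G ρ η (exactlyWhen d φ) ⇔ (evalQF G ρ η φ ⇔ A)
    exactlyWhen⇔ (yes A) = mk⇔ (λ ⊨φ → mk⇔ (λ _ → A) (λ _ → ⊨φ)) (λ φ⇔A → from φ⇔A A)
    exactlyWhen⇔ (no ¬A) =
      mk⇔ (λ ⊭φ → mk⇔ (λ ⊨φ → contradiction ⊨φ ⊭φ) (λ A → contradiction A ¬A)) (λ φ⇔A → ¬A ∘ to φ⇔A)

    apartᶠ⇔ : (t u : Term σ a b) → evalQF G ρ η (apartᶠ t u) ⇔ Apart (graph G) (evalT G η t) (evalT G η u)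
    apartᶠ⇔ t u = ∩[∪N¹]⊆⊥⇔Apart (graph G)

    ∃ᵛ*⇔ : (m : ℕ) (φ : Formula σ (m + a) b) →
           eval G ρ η (∃ᵛ* m φ) ⇔ ∃ λ (xs : Fin m → V) → eval G (prepend m xs ρ) η φ
    ∃ᵛ*⇔ zero φ = mk⇔ (λ ⊨φ → (λ ()) , ⊨φ) proj₂
    ∃ᵛ*⇔ (suc m) φ = mk⇔
      (λ ⊨∃φ → let (xs , x , ⊨φ) = to (∃ᵛ*⇔ m (exV φ)) ⊨∃φ in (λ { zero → x ; (suc i) → xs i }) , ⊨φ)
      (λ (xs , ⊨φ) → from (∃ᵛ*⇔ m (exV φ)) (xs ∘ suc , xs zero , ⊨φ))

    ∃ˢ*⇔ : (m : ℕ) (φ : Formula σ a (m + b)) →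
           eval G ρ η (∃ˢ* m φ) ⇔ ∃ λ (Xs : Fin m → 𝒫V) → eval G ρ (prepend m Xs η) φ
    ∃ˢ*⇔ zero φ = mk⇔ (λ ⊨φ → (λ ()) , ⊨φ) proj₂
    ∃ˢ*⇔ (suc m) φ = mk⇔
      (λ ⊨∃φ → let (Xs , X , ⊨φ) = to (∃ˢ*⇔ m (exS φ)) ⊨∃φ in (λ { zero → X ; (suc i) → Xs i }) , ⊨φ)
      (λ (Xs , ⊨φ) → from (∃ˢ*⇔ m (exS φ)) (Xs ∘ suc , Xs zero , ⊨φ))

∃-prepend⇔ : {σ : ℕ} (G : CGraph σ) {A : Set} {c : ℕ} (m : ℕ) (ρ : Fin c → A) (P : (Fin m → A) → Set) →
             (∀ {f g} → (∀ i → f i ≡ g i) → P f → P g) →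
             (∃ λ xs → P (λ i → prepend G m xs ρ (i ↑ˡ c))) ⇔ ∃ P
∃-prepend⇔ G m ρ P P-resp = mk⇔
  (λ (xs , Pxs) → _ , Pxs)
  (λ (xs , Pxs) → xs , P-resp (λ i → sym (prepend-↑ˡ G m xs ρ i)) Pxs)

-- Feedback vertex set and longest induced path

Expressible : (Graph → Set) → Set
Expressible Q = Σ (Sentence 0) λ φ → ∀ (G : Graph) → (plain G ⊨ φ) ⇔ Q G

fvs-expressible : ∀ k → Expressible (λ G → FVS G k)
fvs-expressible k = exS (qf (and (size≤ (svar zero) k) (acy (compl (svar zero))))) , λ G → mk⇔
  (λ (X , ∣X∣≤k , acyclic) → X , ∣X∣≤k , Acyclic-anti G x∉p⇒x∈∁p acyclic)
  (λ (X , ∣X∣≤k , acyclic) → X , ∣X∣≤k , Acyclic-anti G x∈∁p⇒x∉p acyclic)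

inducedPathClause : ∀ {k} → Fin k → Fin k → QF 0 (k + 0) 0
inducedPathClause i j =
  and (exactlyWhen (consecutive? i j) (edge (i ↑ˡ 0) (j ↑ˡ 0)))
      (unless (i ≟ j) (neg (eqv (i ↑ˡ 0) (j ↑ˡ 0))))

inducedPathFormula : (k : ℕ) → QF 0 (k + 0) 0
inducedPathFormula k = ⋀ k λ i → ⋀ k λ j → inducedPathClause i j

inducedPathFormula⇔ : (G : Graph) (k : ℕ) (ρ : Fin (k + 0) → Fin (n G)) (η : Fin 0 → Subset (n G)) →
                      evalQF (plain G) ρ η (inducedPathFormula k) ⇔ IsInducedPath G k (λ i → ρ (i ↑ˡ 0))
inducedPathFormula⇔ G k ρ η = mk⇔ ⇒ ⇐
  where
  G′ : CGraph 0
  G′ = plain G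
  ⇒ : evalQF G′ ρ η (inducedPathFormula k) → IsInducedPath G k (λ i → ρ (i ↑ˡ 0))
  ⇒ ⊨φ = injective , adj
    where
    clause : ∀ i j → evalQF G′ ρ η (inducedPathClause i j)
    clause i j = to (⋀⇔ G′ ρ η k _) (to (⋀⇔ G′ ρ η k _) ⊨φ i) j
    injective : Injective _≡_ _≡_ (λ i → ρ (i ↑ˡ 0))
    injective {i} {j} xi≡xj with i ≟ j
    ... | yes i≡j = i≡j
    ... | no i≢j = contradiction xi≡xj (to (unless⇔ G′ ρ η (i ≟ j)) (proj₂ (clause i j)) i≢j)
    adj : ∀ i j → Adj G (ρ (i ↑ˡ 0)) (ρ (j ↑ˡ 0)) ⇔ Consecutive i j
    adj i j = to (exactlyWhen⇔ G′ ρ η (consecutive? i j)) (proj₁ (clause i j))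
  ⇐ : IsInducedPath G k (λ i → ρ (i ↑ˡ 0)) → evalQF G′ ρ η (inducedPathFormula k)
  ⇐ (injective , adj) = from (⋀⇔ G′ ρ η k _) λ i → from (⋀⇔ G′ ρ η k _) λ j →
    from (exactlyWhen⇔ G′ ρ η (consecutive? i j)) (adj i j) ,
    from (unless⇔ G′ ρ η (i ≟ j)) (λ i≢j xi≡xj → i≢j (injective xi≡xj))

lip-expressible : ∀ k → Expressible (λ G → LIP G k)
lip-expressible k = ∃ᵛ* k (qf (inducedPathFormula k)) , λ G →
  ∃-prepend⇔ (plain G) k (λ ()) (IsInducedPath G k) (IsInducedPath-resp G)
  ⇔-∘ (∃-cong (inducedPathFormula⇔ G k _ _)
  ⇔-∘ ∃ᵛ*⇔ (plain G) (λ ()) (λ ()) k (qf (inducedPathFormula k)))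

-- Acyclic colouring

record ColourClasses (G : Graph) (k : ℕ) (X : Fin k → Subset (n G)) : Set where
  field
    cover       : ∀ v → ∃ λ i → v ∈ X i
    independent : ∀ i → NoEdge G (X i) (X i)
    forest      : ∀ i j → Acyclic G (λ v → v ∈ X i ∪ X j)

ColourClasses-resp : (G : Graph) {k : ℕ} {X Y : Fin k → Subset (n G)} → (∀ i → X i ≡ Y i) →
                     ColourClasses G k X → ColourClasses G k Y
ColourClasses-resp G X≗Y cc = record
  { cover = λ v → let (i , v∈Xi) = cover v in i , subst (v ∈_) (X≗Y i) v∈Xi
  ; independent = λ i → subst (λ Z → NoEdge G Z Z) (X≗Y i) (independent i)
  ; forest = λ i j → subst₂ (λ Z Z′ → Acyclic G (λ v → v ∈ Z ∪ Z′)) (X≗Y i) (X≗Y j) (forest i j) }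
  where open ColourClasses cc

colourClasses⇔acyclicColouring : (G : Graph) (k : ℕ) → ∃ (ColourClasses G k) ⇔ AcyclicColoring G k
colourClasses⇔acyclicColouring G k = mk⇔ ⇐ ⇒
  where
  ⇒ : AcyclicColoring G k → ∃ (ColourClasses G k)
  ⇒ (col , proper , acyclic) = X , record { cover = cover ; independent = independent ; forest = forest }
    where
    X : Fin k → Subset (n G)
    X i = subsetOf (λ v → col v ≟ i)
    cover : ∀ v → ∃ λ i → v ∈ X i
    cover v = col v , from ∈-subsetOf⇔ refl
    independent : ∀ i → NoEdge G (X i) (X i)
    independent i x∈Xi y∈Xi xy = proper _ _ xy (trans (to ∈-subsetOf⇔ x∈Xi) (sym (to ∈-subsetOf⇔ y∈Xi)))
    forest : ∀ i j → Acyclic G (λ v → v ∈ X i ∪ X j)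
    forest i j with i ≟ j
    ... | no i≢j =
      Acyclic-anti G (λ v∈ → Sum.map (to ∈-subsetOf⇔) (to ∈-subsetOf⇔) (x∈p∪q⁻ (X i) _ v∈)) (acyclic i j i≢j)
    ... | yes refl = λ C → let (x , y , x∈ , y∈ , xy) = cycle⇒edge G C in
      independent i (Sum.reduce (x∈p∪q⁻ (X i) _ x∈)) (Sum.reduce (x∈p∪q⁻ (X i) _ y∈)) xy
  ⇐ : ∃ (ColourClasses G k) → AcyclicColoring G k
  ⇐ (X , cc) = col , proper , acyclic
    where
    open ColourClasses cc
    col : Fin (n G) → Fin k
    col v = proj₁ (cover v)
    proper : ∀ u v → Adj G u v → col u ≢ col v
    proper u v uv cu≡cv =
      independent (col v) (subst (λ i → u ∈ X i) cu≡cv (proj₂ (cover u))) (proj₂ (cover v)) uv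
    acyclic : ∀ i j → i ≢ j → Acyclic G (λ v → col v ≡ i ⊎ col v ≡ j)
    acyclic i j _ = Acyclic-anti G
      (λ { {v} (inj₁ refl) → x∈p∪q⁺ (inj₁ (proj₂ (cover v)))
         ; {v} (inj₂ refl) → x∈p∪q⁺ (inj₂ (proj₂ (cover v))) })
      (forest i j)

colourClassesFormula : (k : ℕ) → QF 0 0 (k + 0)
colourClassesFormula k =
  and (tsub (compl empty) (⋃ k X))
      (and (⋀ k λ i → tsub (X i ∩ₜ N¹ (X i)) empty)
           (⋀ k λ i → ⋀ k λ j → acy (X i ∪ₜ X j)))
  where
  X : Fin k → Term 0 0 (k + 0)
  X i = svar (i ↑ˡ 0)

colourClassesFormula⇔ : (G : Graph) (k : ℕ) (ρ : Fin 0 → Fin (n G)) (η : Fin (k + 0) → Subset (n G)) →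
                        evalQF (plain G) ρ η (colourClassesFormula k) ⇔ ColourClasses G k (λ i → η (i ↑ˡ 0))
colourClassesFormula⇔ G k ρ η = mk⇔
  (λ (cover , independent , forest) → record
    { cover = λ v → to (∈⋃⇔ G′ ρ η k _) (cover (x∉p⇒x∈∁p ∉⊥))
    ; independent = λ i → to (∩N¹⊆⊥⇔NoEdge G) (to (⋀⇔ G′ ρ η k _) independent i)
    ; forest = λ i j → to (⋀⇔ G′ ρ η k _) (to (⋀⇔ G′ ρ η k _) forest i) j })
  (λ cc → let open ColourClasses cc in
    (λ {v} _ → from (∈⋃⇔ G′ ρ η k _) (cover v)) ,
    from (⋀⇔ G′ ρ η k _) (λ i {x} → from (∩N¹⊆⊥⇔NoEdge G) (independent i) {x}) ,
    from (⋀⇔ G′ ρ η k _) (λ i → from (⋀⇔ G′ ρ η k _) (forest i)))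
  where
    G′ : CGraph 0
    G′ = plain G

acyclicColouring-expressible : ∀ k → Expressible (λ G → AcyclicColoring G k)
acyclicColouring-expressible k = ∃ˢ* k (qf (colourClassesFormula k)) , λ G →
  colourClasses⇔acyclicColouring G k
  ⇔-∘ (∃-prepend⇔ (plain G) k (λ ()) (ColourClasses G k) (ColourClasses-resp G)
  ⇔-∘ (∃-cong (colourClassesFormula⇔ G k _ _)
  ⇔-∘ ∃ˢ*⇔ (plain G) (λ ()) (λ ()) k (qf (colourClassesFormula k))))

-- Induced disjoint paths

module _ {k : ℕ} where

  private
    Xₜ : Fin k → Term k 0 (k + 0)
    Xₜ i = svar (i ↑ˡ 0)

  offSharedₜ : Fin k → Fin k → Fin k → Term k 0 (k + 0)
  offSharedₜ i j l = Xₜ l ∖ₜ (rel i ∩ₜ rel j)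

  pathSetsFormula : QF k 0 (k + 0)
  pathSetsFormula =
    and (⋀ k λ i → and (tsub (rel i) (Xₜ i)) (conn (Xₜ i)))
        (⋀ k λ i → ⋀ k λ j → unless (i ≟ j) (apartᶠ (offSharedₜ i j i) (offSharedₜ i j j)))

module _ {k : ℕ} (G : CGraph k) where

  private
    V : Set
    V = Fin (n (graph G))

  terminals : Fin k → Subset (n (graph G))
  terminals i = tabulate (P G i)

  sharedTerminals : Fin k → Fin k → Subset (n (graph G))
  sharedTerminals i j = terminals i ∩ terminals j

  record PathSets (X : Fin k → Subset (n (graph G))) : Set where
    field
      terminals⊆ : ∀ i → terminals i ⊆ X i
      connected  : ∀ i → Connected (graph G) (_∈ X i)
      apart      : ∀ i j → i ≢ j → Apart (graph G) (X i ─ sharedTerminals i j) (X j ─ sharedTerminals i j)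

  PathSets-resp : {X Y : Fin k → Subset (n (graph G))} → (∀ i → X i ≡ Y i) → PathSets X → PathSets Y
  PathSets-resp X≗Y ps = record
    { terminals⊆ = λ i → subst (terminals i ⊆_) (X≗Y i) (terminals⊆ i)
    ; connected = λ i → subst (λ Z → Connected (graph G) (_∈ Z)) (X≗Y i) (connected i)
    ; apart = λ i j → subst₂ (λ Z Z′ → i ≢ j → Apart (graph G) (Z ─ sharedTerminals i j) (Z′ ─ sharedTerminals i j))
                             (X≗Y i) (X≗Y j) (apart i j) }
    where open PathSets ps

  pathSetsFormula⇔ : (ρ : Fin 0 → V) (η : Fin (k + 0) → Subset (n (graph G))) →
                     evalQF G ρ η pathSetsFormula ⇔ PathSets (λ i → η (i ↑ˡ 0))
  pathSetsFormula⇔ ρ η = mk⇔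
    (λ (ends , separated) → record
      { terminals⊆ = λ i {x} → proj₁ (to (⋀⇔ G ρ η k _) ends i) {x}
      ; connected = λ i → proj₂ (to (⋀⇔ G ρ η k _) ends i)
      ; apart = λ i j i≢j → to (apartᶠ⇔ G ρ η (offSharedₜ i j i) (offSharedₜ i j j)) λ {x} →
          to (unless⇔ G ρ η (i ≟ j)) (to (⋀⇔ G ρ η k _) (to (⋀⇔ G ρ η k _) separated i) j) i≢j {x} })
    (λ ps → let open PathSets ps in
      from (⋀⇔ G ρ η k _) (λ i → (λ {x} → terminals⊆ i {x}) , connected i) ,
      from (⋀⇔ G ρ η k _) λ i → from (⋀⇔ G ρ η k _) λ j →
        from (unless⇔ G ρ η (i ≟ j)) λ i≢j {x} →
          from (apartᶠ⇔ G ρ η (offSharedₜ i j i) (offSharedₜ i j j)) (apart i j i≢j) {x})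

  module _ (s t : Fin k → V) (P≡st : ∀ i v → (P G i v ≡ true) ⇔ (v ≡ s i ⊎ v ≡ t i)) where

    ∈terminals⇔ : ∀ {i v} → v ∈ terminals i ⇔ (v ≡ s i ⊎ v ≡ t i)
    ∈terminals⇔ {i} {v} = P≡st i v ⇔-∘ (T-≡ ⇔-∘ ∈-tabulate⇔)

    SharedTerminal : Fin k → Fin k → V → Set
    SharedTerminal i j v = (v ≡ s i ⊎ v ≡ t i) × (v ≡ s j ⊎ v ≡ t j)

    ∈sharedTerminals⇔ : ∀ {i j v} → v ∈ sharedTerminals i j ⇔ SharedTerminal i j v
    ∈sharedTerminals⇔ {i} {j} = mk⇔
      (λ v∈ → let (v∈i , v∈j) = x∈p∩q⁻ (terminals i) _ v∈ in to ∈terminals⇔ v∈i , to ∈terminals⇔ v∈j)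
      (λ (v∈i , v∈j) → x∈p∩q⁺ (from ∈terminals⇔ v∈i , from ∈terminals⇔ v∈j))

    pathSets⇔IDP : ∃ PathSets ⇔ IDP (graph G) s t
    pathSets⇔IDP = mk⇔ ⇒ ⇐
      where
      ⇒ : ∃ PathSets → IDP (graph G) s t
      ⇒ (X , ps) = proj₁ ∘ path , separated
        where
        open PathSets ps
        path : ∀ i → Σ (InducedSTPath (graph G) (s i) (t i)) λ π → ∀ x → OnPath π x → x ∈ X i
        path i = walk⇒inducedPath (connected i (s i) (t i)
          (terminals⊆ i (from ∈terminals⇔ (inj₁ refl))) (terminals⊆ i (from ∈terminals⇔ (inj₂ refl))))
        off-shared : ∀ i j l {x} → OnPath (proj₁ (path l)) x → ¬ SharedTerminal i j x →
                     x ∈ X l ─ sharedTerminals i j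
        off-shared i j l x∈πl ¬shared = x∈p∧x∉q⇒x∈p─q (proj₂ (path l) _ x∈πl) (¬shared ∘ to ∈sharedTerminals⇔)
        separated : ∀ i j → i ≢ j → ∀ u v → OnPath (proj₁ (path i)) u → OnPath (proj₁ (path j)) v →
                    ¬ SharedTerminal i j u → ¬ SharedTerminal i j v → u ≢ v × ¬ Adj (graph G) u v
        separated i j i≢j u v u∈πi v∈πj ¬shared-u ¬shared-v =
          apart i j i≢j (off-shared i j i u∈πi ¬shared-u) (off-shared i j j v∈πj ¬shared-v)
      ⇐ : IDP (graph G) s t → ∃ PathSets
      ⇐ (π , separated) =
        X , record { terminals⊆ = terminals⊆ ; connected = rangeSet-connected ∘ W ; apart = apart }
        where
        W : ∀ i → Walk (graph G) (OnPath (π i)) (s i) (t i)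
        W i = pathWalk (π i)
        X : Fin k → Subset (n (graph G))
        X i = rangeSet (W i)
        terminals⊆ : ∀ i → terminals i ⊆ X i
        terminals⊆ i x∈ with to ∈terminals⇔ x∈
        ... | inj₁ refl = from ∈-subsetOf⇔ (start∈Range (W i))
        ... | inj₂ refl = from ∈-subsetOf⇔ (end∈Range (W i))
        onPath : ∀ l {A x} → x ∈ X l ─ A → OnPath (π l) x
        onPath l x∈ = Range⊆S (W l) (to ∈-subsetOf⇔ (p─q⊆p (X l) _ x∈))
        apart : ∀ i j → i ≢ j → Apart (graph G) (X i ─ sharedTerminals i j) (X j ─ sharedTerminals i j)
        apart i j i≢j u∈ v∈ = separated i j i≢j _ _ (onPath i u∈) (onPath j v∈)
          (x∈p─q⇒x∉q u∈ ∘ from ∈sharedTerminals⇔) (x∈p─q⇒x∉q v∈ ∘ from ∈sharedTerminals⇔)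

idp-expressible : ∀ k → Σ (Sentence k) λ φ → ∀ (G : CGraph k) (s t : Fin k → Fin (n (graph G))) →
                  (∀ i v → (P G i v ≡ true) ⇔ (v ≡ s i ⊎ v ≡ t i)) → (G ⊨ φ) ⇔ IDP (graph G) s t
idp-expressible k = ∃ˢ* k (qf pathSetsFormula) , λ G s t P≡st →
  pathSets⇔IDP G s t P≡st
  ⇔-∘ (∃-prepend⇔ G k (λ ()) (PathSets G) (PathSets-resp G)
  ⇔-∘ (∃-cong (pathSetsFormula⇔ G _ _)
  ⇔-∘ ∃ˢ*⇔ G (λ ()) (λ ()) k (qf pathSetsFormula)))

-- Induced topological minors

Edge : (H : Graph) → Fin (n H) → Fin (n H) → Set
Edge H a c = toℕ a < toℕ c × Adj H a c

edge? : (H : Graph) (a c : Fin (n H)) → Dec (Edge H a c)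
edge? H a c = (toℕ a <? toℕ c) ×-dec (E H a c Boolₚ.≟ true)

module _ (H G : Graph) where

  private
    h : ℕ
    h = n H

  interior : (B : Fin h → Subset (n G)) (S : Fin h → Fin h → Subset (n G)) → Fin h → Fin h → Subset (n G)
  interior B S a c = S a c ─ (B a ∪ B c)

  EdgeSets : (x : Fin h → Fin (n G)) (B : Fin h → Subset (n G)) (S : Fin h → Fin h → Subset (n G)) →
             Fin h → Fin h → Set
  EdgeSets x B S a c =
    x a ∈ S a c × x c ∈ S a c × Connected G (_∈ S a c) ×
    (∀ b → ¬ (b ≡ a ⊎ b ≡ c) → Apart G (interior B S a c) (B b)) ×
    (∀ b d → Edge H b d → ¬ (b ≡ a × d ≡ c) → Apart G (interior B S a c) (interior B S b d))

  -- Terms cannot mention vertex variables, so the branch vertex x a enters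
  -- neighbourhood terms through the singleton B a = {x a}.
  record SubdivisionSets (x : Fin h → Fin (n G)) (B : Fin h → Subset (n G))
                         (S : Fin h → Fin h → Subset (n G)) : Set where
    field
      B-size      : ∀ a → ∣ B a ∣ ≡ 1
      x∈B         : ∀ a → x a ∈ B a
      x-injective : ∀ a c → a ≢ c → x a ≢ x c
      non-edge    : ∀ a c → ¬ Adj H a c → ¬ Adj G (x a) (x c)
      start∈S     : ∀ a c → Edge H a c → x a ∈ S a c
      end∈S       : ∀ a c → Edge H a c → x c ∈ S a c
      S-connected : ∀ a c → Edge H a c → Connected G (_∈ S a c)
      interior-apart-branch   : ∀ a c → Edge H a c → ∀ b → ¬ (b ≡ a ⊎ b ≡ c) → Apart G (interior B S a c) (B b)
      interior-apart-interior : ∀ a c → Edge H a c → ∀ b d → Edge H b d → ¬ (b ≡ a × d ≡ c) →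
                                Apart G (interior B S a c) (interior B S b d)

  SubdivisionSets-resp : ∀ {x x′ B B′ S S′} →
                         (∀ a → x a ≡ x′ a) → (∀ a → B a ≡ B′ a) → (∀ a c → S a c ≡ S′ a c) →
                         SubdivisionSets x B S → SubdivisionSets x′ B′ S′
  SubdivisionSets-resp {x} {x′} {B} {B′} {S} {S′} x≗x′ B≗B′ S≗S′ sets = record
    { B-size = λ a → subst (λ Z → ∣ Z ∣ ≡ 1) (B≗B′ a) (B-size a)
    ; x∈B = λ a → subst₂ _∈_ (x≗x′ a) (B≗B′ a) (x∈B a)
    ; x-injective = λ a c a≢c xa≡xc → x-injective a c a≢c (trans (x≗x′ a) (trans xa≡xc (sym (x≗x′ c))))
    ; non-edge = λ a c ¬ac → non-edge a c ¬ac ∘ subst₂ (Adj G) (sym (x≗x′ a)) (sym (x≗x′ c))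
    ; start∈S = λ a c e → subst₂ _∈_ (x≗x′ a) (S≗S′ a c) (start∈S a c e)
    ; end∈S = λ a c e → subst₂ _∈_ (x≗x′ c) (S≗S′ a c) (end∈S a c e)
    ; S-connected = λ a c e → subst (λ Z → Connected G (_∈ Z)) (S≗S′ a c) (S-connected a c e)
    ; interior-apart-branch = λ a c e b b∉ac → subst₂ (Apart G) (interior-resp a c) (B≗B′ b)
        (interior-apart-branch a c e b b∉ac)
    ; interior-apart-interior = λ a c e b d e′ bd≢ac → subst₂ (Apart G) (interior-resp a c) (interior-resp b d)
        (interior-apart-interior a c e b d e′ bd≢ac) }
    where
    open SubdivisionSets sets
    interior-resp : ∀ a c → interior B S a c ≡ interior B′ S′ a c
    interior-resp a c = cong₂ _─_ (S≗S′ a c) (cong₂ _∪_ (B≗B′ a) (B≗B′ c))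

module _ (H : Graph) where

  private
    h : ℕ
    h = n H

  branchVar : Fin h → Fin (h + 0)
  branchVar a = a ↑ˡ 0

  branchSetVar : Fin h → Fin (h * h + (h + 0))
  branchSetVar a = (h * h) ↑ʳ (a ↑ˡ 0)

  pathSetVar : Fin h → Fin h → Fin (h * h + (h + 0))
  pathSetVar a c = combine a c ↑ˡ (h + 0)

  private
    Bₜ : Fin h → Term 0 (h + 0) (h * h + (h + 0))
    Bₜ a = svar (branchSetVar a)
    Sₜ Iₜ : Fin h → Fin h → Term 0 (h + 0) (h * h + (h + 0))
    Sₜ a c = svar (pathSetVar a c)
    Iₜ a c = Sₜ a c ∖ₜ (Bₜ a ∪ₜ Bₜ c)

  edgeClause : Fin h → Fin h → QF 0 (h + 0) (h * h + (h + 0))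
  edgeClause a c =
    and (mem (branchVar a) (pathSetVar a c)) (and (mem (branchVar c) (pathSetVar a c)) (and (conn (Sₜ a c))
    (and (⋀ h λ b → unless ((b ≟ a) ⊎-dec (b ≟ c)) (apartᶠ (Iₜ a c) (Bₜ b)))
         (⋀ h λ b → ⋀ h λ d → when (edge? H b d) (unless ((b ≟ a) ×-dec (d ≟ c)) (apartᶠ (Iₜ a c) (Iₜ b d)))))))

  branchClause : Fin h → QF 0 (h + 0) (h * h + (h + 0))
  branchClause a = and (size= (Bₜ a) 1) (mem (branchVar a) (branchSetVar a))

  pairClause : Fin h → Fin h → QF 0 (h + 0) (h * h + (h + 0))
  pairClause a c =
    and (unless (a ≟ c) (neg (eqv (branchVar a) (branchVar c))))
   (and (unless (E H a c Boolₚ.≟ true) (neg (edge (branchVar a) (branchVar c))))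
        (when (edge? H a c) (edgeClause a c)))

  subdivisionFormula : QF 0 (h + 0) (h * h + (h + 0))
  subdivisionFormula = and (⋀ h branchClause) (⋀ h λ a → ⋀ h λ c → pairClause a c)

  module _ (G : Graph) (ρ : Fin (h + 0) → Fin (n G)) (η : Fin (h * h + (h + 0)) → Subset (n G)) where

    private
      G′ : CGraph 0
      G′ = plain G
      x : Fin h → Fin (n G)
      x = ρ ∘ branchVar
      B : Fin h → Subset (n G)
      B = η ∘ branchSetVar
      S : Fin h → Fin h → Subset (n G)
      S a c = η (pathSetVar a c)

    edgeClause⇔ : ∀ a c → evalQF G′ ρ η (edgeClause a c) ⇔ EdgeSets H G x B S a c
    edgeClause⇔ a c = mk⇔
      (λ (xa∈ , xc∈ , connected , apart-B , apart-I) → xa∈ , xc∈ , connected ,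
        (λ b b∉ac → to (apartᶠ⇔ G′ ρ η (Iₜ a c) (Bₜ b)) λ {y} →
           to (unless⇔ G′ ρ η ((b ≟ a) ⊎-dec (b ≟ c))) (to (⋀⇔ G′ ρ η h _) apart-B b) b∉ac {y}) ,
        (λ b d bd bd≢ac → to (apartᶠ⇔ G′ ρ η (Iₜ a c) (Iₜ b d)) λ {y} →
           to (unless⇔ G′ ρ η ((b ≟ a) ×-dec (d ≟ c)))
              (to (when⇔ G′ ρ η (edge? H b d)) (to (⋀⇔ G′ ρ η h _) (to (⋀⇔ G′ ρ η h _) apart-I b) d) bd)
              bd≢ac {y}))
      (λ (xa∈ , xc∈ , connected , apart-B , apart-I) → xa∈ , xc∈ , connected ,
        from (⋀⇔ G′ ρ η h _) (λ b → from (unless⇔ G′ ρ η ((b ≟ a) ⊎-dec (b ≟ c))) λ b∉ac {y} →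
          from (apartᶠ⇔ G′ ρ η (Iₜ a c) (Bₜ b)) (apart-B b b∉ac) {y}) ,
        from (⋀⇔ G′ ρ η h _) λ b → from (⋀⇔ G′ ρ η h _) λ d →
          from (when⇔ G′ ρ η (edge? H b d)) λ bd → from (unless⇔ G′ ρ η ((b ≟ a) ×-dec (d ≟ c))) λ bd≢ac {y} →
            from (apartᶠ⇔ G′ ρ η (Iₜ a c) (Iₜ b d)) (apart-I b d bd bd≢ac) {y})

    subdivisionFormula⇔ : evalQF G′ ρ η subdivisionFormula ⇔ SubdivisionSets H G x B S
    subdivisionFormula⇔ = mk⇔ ⇒ ⇐
      where
      ⇒ : evalQF G′ ρ η subdivisionFormula → SubdivisionSets H G x B S
      ⇒ (branches , pairs) = record
        { B-size = λ a → proj₁ (branch a)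
        ; x∈B = λ a → proj₂ (branch a)
        ; x-injective = λ a c → to (unless⇔ G′ ρ η (a ≟ c)) (proj₁ (pair a c))
        ; non-edge = λ a c → to (unless⇔ G′ ρ η (E H a c Boolₚ.≟ true)) (proj₁ (proj₂ (pair a c)))
        ; start∈S = λ a c → proj₁ ∘ edge-sets a c
        ; end∈S = λ a c → proj₁ ∘ proj₂ ∘ edge-sets a c
        ; S-connected = λ a c → proj₁ ∘ proj₂ ∘ proj₂ ∘ edge-sets a c
        ; interior-apart-branch = λ a c → proj₁ ∘ proj₂ ∘ proj₂ ∘ proj₂ ∘ edge-sets a c
        ; interior-apart-interior = λ a c → proj₂ ∘ proj₂ ∘ proj₂ ∘ proj₂ ∘ edge-sets a c }
        where
        branch : ∀ a → evalQF G′ ρ η (branchClause a)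
        branch = to (⋀⇔ G′ ρ η h _) branches
        pair : ∀ a c → evalQF G′ ρ η (pairClause a c)
        pair a c = to (⋀⇔ G′ ρ η h _) (to (⋀⇔ G′ ρ η h _) pairs a) c
        edge-sets : ∀ a c → Edge H a c → EdgeSets H G x B S a c
        edge-sets a c = to (edgeClause⇔ a c) ∘ to (when⇔ G′ ρ η (edge? H a c)) (proj₂ (proj₂ (pair a c)))
      ⇐ : SubdivisionSets H G x B S → evalQF G′ ρ η subdivisionFormula
      ⇐ sets =
        from (⋀⇔ G′ ρ η h _) (λ a → B-size a , x∈B a) ,
        from (⋀⇔ G′ ρ η h _) λ a → from (⋀⇔ G′ ρ η h _) λ c →
          from (unless⇔ G′ ρ η (a ≟ c)) (x-injective a c) ,
          from (unless⇔ G′ ρ η (E H a c Boolₚ.≟ true)) (non-edge a c) ,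
          from (when⇔ G′ ρ η (edge? H a c)) λ e → from (edgeClause⇔ a c)
            (start∈S a c e , end∈S a c e , S-connected a c e ,
             interior-apart-branch a c e , interior-apart-interior a c e)
        where open SubdivisionSets sets

module SubdivisionFromSets (H G : Graph) {x : Fin (n H) → Fin (n G)} {B : Fin (n H) → Subset (n G)}
                           {S : Fin (n H) → Fin (n H) → Subset (n G)} (sets : SubdivisionSets H G x B S) where

  open SubdivisionSets sets

  private
    h : ℕ
    h = n H
    V : Set
    V = Fin (n G)
    variable
      a b c d : Fin h

  Edge⇒≢ : Edge H a c → a ≢ c
  Edge⇒≢ (a<c , _) refl = ℕₚ.<-irrefl refl a<c

  edgeBranch : Edge H a c → Σ (Branch G) (IsBranch G (_∈ S a c) (x a) (x c))
  edgeBranch {a} {c} e =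
    connected⇒branch G (x-injective a c (Edge⇒≢ e)) (S-connected a c e) (start∈S a c e) (end∈S a c e)

  -- Non-edges of H get a dummy branch, which ι never uses.
  branchOf : ∀ a c → Dec (Edge H a c) → Branch G
  branchOf a c (yes e) = proj₁ (edgeBranch e)
  branchOf a c (no _) = record { ℓ = 0 ; path = λ _ → x a }

  branchOf-isBranch : ∀ a c (d : Dec (Edge H a c)) → Edge H a c →
                      IsBranch G (_∈ S a c) (x a) (x c) (branchOf a c d)
  branchOf-isBranch a c (yes e) _ = proj₂ (edgeBranch e)
  branchOf-isBranch a c (no ¬e) e = contradiction e ¬e

  ℓ : Fin h → Fin h → ℕ
  ℓ a c = Branch.ℓ (branchOf a c (edge? H a c))

  q : ∀ a c → Fin (2 + ℓ a c) → V
  q a c = Branch.path (branchOf a c (edge? H a c))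

  module Branchₑ {a c : Fin h} (e : Edge H a c) where
    open IsBranch (branchOf-isBranch a c (edge? H a c) e)
    open InducedPath⁺ {G = G} induced public

    inner∈interior : ∀ i → q a c (inner i) ∈ interior H G B S a c
    inner∈interior i = x∈p∧x∉q⇒x∈p─q (inside (inner i)) λ ∈Ba∪Bc →
      [ inner≢first i ∘ (λ ≡xa → trans ≡xa (sym first)) ∘ ≡x a
      , inner≢last i ∘ (λ ≡xc → trans ≡xc (sym final)) ∘ ≡x c ] (x∈p∪q⁻ (B a) _ ∈Ba∪Bc)
      where
      ≡x : ∀ b {v} → v ∈ B b → v ≡ x b
      ≡x b v∈ = ∣p∣≡1⇒x≡y (B-size b) v∈ (x∈B b)

    branch≢inner : ∀ b i → x b ≢ q a c (inner i)
    branch≢inner b i xb≡v with b ≟ a | b ≟ c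
    ... | yes refl | _ = inner≢first i (trans (sym xb≡v) (sym first))
    ... | no _ | yes refl = inner≢last i (trans (sym xb≡v) (sym final))
    ... | no b≢a | no b≢c =
      proj₁ (interior-apart-branch a c e b [ b≢a , b≢c ] (inner∈interior i) (x∈B b)) (sym xb≡v)

    ends-adj⇔ : Adj G (x a) (x c) ⇔ ℓ a c ≡ 0
    ends-adj⇔ = subst₂ (λ u v → Adj G u v ⇔ ℓ a c ≡ 0) first final adj-first-last⇔

    branch-inner-adj⇔ : ∀ b i →
      Adj G (x b) (q a c (inner i)) ⇔ ((b ≡ a × toℕ i ≡ 0) ⊎ (b ≡ c × suc (toℕ i) ≡ ℓ a c))
    branch-inner-adj⇔ b i = mk⇔ ⇒ ⇐
      where
      ⇒ : Adj G (x b) (q a c (inner i)) → (b ≡ a × toℕ i ≡ 0) ⊎ (b ≡ c × suc (toℕ i) ≡ ℓ a c)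
      ⇒ xb~v with b ≟ a | b ≟ c
      ... | yes refl | _ =
        inj₁ (refl , to (adj-first-inner⇔ i) (subst (λ u → Adj G u (q a c (inner i))) (sym first) xb~v))
      ... | no _ | yes refl =
        inj₂ (refl , to (adj-last-inner⇔ i) (subst (λ u → Adj G u (q a c (inner i))) (sym final) xb~v))
      ... | no b≢a | no b≢c = contradiction (Adj-sym G xb~v)
            (proj₂ (interior-apart-branch a c e b [ b≢a , b≢c ] (inner∈interior i) (x∈B b)))
      ⇐ : (b ≡ a × toℕ i ≡ 0) ⊎ (b ≡ c × suc (toℕ i) ≡ ℓ a c) → Adj G (x b) (q a c (inner i))
      ⇐ (inj₁ (refl , i≡0)) = subst (λ u → Adj G u (q a c (inner i))) first (from (adj-first-inner⇔ i) i≡0)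
      ⇐ (inj₂ (refl , 1+i≡ℓ)) = subst (λ u → Adj G u (q a c (inner i))) final (from (adj-last-inner⇔ i) 1+i≡ℓ)

  open Branchₑ

  ι : SubdivV H ℓ → V
  ι (inj₁ a) = x a
  ι (inj₂ (a , c , _ , _ , i)) = q a c (inner i)

  inner-apart : (e : Edge H a c) (e′ : Edge H b d) → ¬ (b ≡ a × d ≡ c) → ∀ i j →
                q a c (inner i) ≢ q b d (inner j) × ¬ Adj G (q a c (inner i)) (q b d (inner j))
  inner-apart {a} {c} {b} {d} e e′ bd≢ac i j =
    interior-apart-interior a c e b d e′ bd≢ac (inner∈interior e i) (inner∈interior e′ j)

  inj₂-cong : ∀ {a c a<c a<c′ ac ac′} {i j : Fin (ℓ a c)} → i ≡ j →
              _≡_ {A = SubdivV H ℓ} (inj₂ (a , c , a<c , ac , i)) (inj₂ (a , c , a<c′ , ac′ , j))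
  inj₂-cong {a<c = a<c} {a<c′} {ac} {ac′} refl
    rewrite ℕₚ.<-irrelevant a<c a<c′ | Decidable⇒UIP.≡-irrelevant Boolₚ._≟_ ac ac′ = refl

  ι-injective : Injective _≡_ _≡_ ι
  ι-injective {inj₁ a} {inj₁ c} xa≡xc with a ≟ c
  ... | yes refl = refl
  ... | no a≢c = contradiction xa≡xc (x-injective a c a≢c)
  ι-injective {inj₁ b} {inj₂ (a , c , a<c , ac , i)} xb≡v = contradiction xb≡v (branch≢inner (a<c , ac) b i)
  ι-injective {inj₂ (a , c , a<c , ac , i)} {inj₁ b} v≡xb =
    contradiction (sym v≡xb) (branch≢inner (a<c , ac) b i)
  ι-injective {inj₂ (a , c , a<c , ac , i)} {inj₂ (b , d , b<d , bd , j)} v≡w with b ≟ a | d ≟ c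
  ... | yes refl | yes refl = inj₂-cong (inner-injective (a<c , ac) v≡w)
  ... | yes refl | no d≢c = contradiction v≡w (proj₁ (inner-apart (a<c , ac) (b<d , bd) (d≢c ∘ proj₂) i j))
  ... | no b≢a | _ = contradiction v≡w (proj₁ (inner-apart (a<c , ac) (b<d , bd) (b≢a ∘ proj₁) i j))

  branches-adj⇔ : ∀ a c → Adj G (x a) (x c) ⇔ SubdivAdj H ℓ (inj₁ a) (inj₁ c)
  branches-adj⇔ a c = mk⇔ ⇒ ⇐
    where
    ⇒ : Adj G (x a) (x c) → SubdivAdj H ℓ (inj₁ a) (inj₁ c)
    ⇒ xa~xc = by-order (ℕₚ.<-cmp (toℕ a) (toℕ c))
      where
      ac : Adj H a c
      ac = decidable-stable (E H a c Boolₚ.≟ true) (λ ¬ac → non-edge a c ¬ac xa~xc)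
      by-order : Tri (toℕ a < toℕ c) (toℕ a ≡ toℕ c) (toℕ c < toℕ a) → SubdivAdj H ℓ (inj₁ a) (inj₁ c)
      by-order (tri< a<c _ _) = inj₁ (a<c , ac , to (ends-adj⇔ (a<c , ac)) xa~xc)
      by-order (tri≈ _ a≡c _) =
        contradiction (subst (λ z → Adj G (x a) (x z)) (sym (Finₚ.toℕ-injective a≡c)) xa~xc) (Adj-irrefl G)
      by-order (tri> _ _ c<a) =
        inj₂ (c<a , Adj-sym H ac , to (ends-adj⇔ (c<a , Adj-sym H ac)) (Adj-sym G xa~xc))
    ⇐ : SubdivAdj H ℓ (inj₁ a) (inj₁ c) → Adj G (x a) (x c)
    ⇐ (inj₁ (a<c , ac , ℓ≡0)) = from (ends-adj⇔ (a<c , ac)) ℓ≡0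
    ⇐ (inj₂ (c<a , ca , ℓ≡0)) = Adj-sym G (from (ends-adj⇔ (c<a , ca)) ℓ≡0)

  inners-adj⇔ : ∀ {a c b d} (e : Edge H a c) (e′ : Edge H b d) i j →
                Adj G (q a c (inner i)) (q b d (inner j)) ⇔ (a ≡ b × c ≡ d × Consecutiveℕ (toℕ i) (toℕ j))
  inners-adj⇔ {a} {c} {b} {d} e e′ i j = mk⇔ ⇒ ⇐
    where
    ⇒ : Adj G (q a c (inner i)) (q b d (inner j)) → a ≡ b × c ≡ d × Consecutiveℕ (toℕ i) (toℕ j)
    ⇒ v~w with b ≟ a | d ≟ c
    ... | yes refl | yes refl = refl , refl , to (adj-inner⇔ e i j) v~w
    ... | yes refl | no d≢c = contradiction v~w (proj₂ (inner-apart e e′ (d≢c ∘ proj₂) i j))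
    ... | no b≢a | _ = contradiction v~w (proj₂ (inner-apart e e′ (b≢a ∘ proj₁) i j))
    ⇐ : a ≡ b × c ≡ d × Consecutiveℕ (toℕ i) (toℕ j) → Adj G (q a c (inner i)) (q b d (inner j))
    ⇐ (refl , refl , i~j) = from (adj-inner⇔ e i j) i~j

  ι-adj⇔ : ∀ u w → Adj G (ι u) (ι w) ⇔ SubdivAdj H ℓ u w
  ι-adj⇔ (inj₁ a) (inj₁ c) = branches-adj⇔ a c
  ι-adj⇔ (inj₁ b) (inj₂ (a , c , a<c , ac , i)) = branch-inner-adj⇔ (a<c , ac) b i
  ι-adj⇔ (inj₂ (a , c , a<c , ac , i)) (inj₁ b) =
    branch-inner-adj⇔ (a<c , ac) b i ⇔-∘ mk⇔ (Adj-sym G) (Adj-sym G)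
  ι-adj⇔ (inj₂ (a , c , a<c , ac , i)) (inj₂ (b , d , b<d , bd , j)) = inners-adj⇔ (a<c , ac) (b<d , bd) i j

  inducedTopMinor : InducedTopMinor H G
  inducedTopMinor = ℓ , ι , ι-injective , ι-adj⇔

module SetsFromSubdivision (H G : Graph) (ℓ : Fin (n H) → Fin (n H) → ℕ) (ι : SubdivV H ℓ → Fin (n G))
                           (ι-injective : Injective _≡_ _≡_ ι)
                           (ι-adj⇔ : ∀ u w → Adj G (ι u) (ι w) ⇔ SubdivAdj H ℓ u w) where

  private
    h : ℕ
    h = n H
    V : Set
    V = Fin (n G)
    variable
      a b c d : Fin h

  x : Fin h → V
  x a = ι (inj₁ a)

  B : Fin h → Subset (n G)
  B a = ⁅ x a ⁆

  module BranchWalk {a c : Fin h} (e : Edge H a c) where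

    interiorVertex : Fin (ℓ a c) → V
    interiorVertex i = ι (inj₂ (a , c , proj₁ e , proj₂ e , i))

    vertex : ℕ → V
    vertex zero = x a
    vertex (suc k) with k <? ℓ a c
    ... | yes k<ℓ = interiorVertex (fromℕ< k<ℓ)
    ... | no _ = x c

    vertex-< : ∀ k (k<ℓ : k < ℓ a c) → vertex (suc k) ≡ interiorVertex (fromℕ< k<ℓ)
    vertex-< k k<ℓ with k <? ℓ a c
    ... | yes _ = refl
    ... | no k≮ℓ = contradiction k<ℓ k≮ℓ

    vertex-≮ : ∀ k → ¬ k < ℓ a c → vertex (suc k) ≡ x c
    vertex-≮ k k≮ℓ with k <? ℓ a c
    ... | yes k<ℓ = contradiction k<ℓ k≮ℓ
    ... | no _ = refl

    step : ∀ k → k < suc (ℓ a c) → Adj G (vertex k) (vertex (suc k))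
    step zero _ with 0 <? ℓ a c
    ... | yes 0<ℓ = from (ι-adj⇔ (inj₁ a) (inj₂ _)) (inj₁ (refl , Finₚ.toℕ-fromℕ< 0<ℓ))
    ... | no 0≮ℓ = from (ι-adj⇔ (inj₁ a) (inj₁ c)) (inj₁ (proj₁ e , proj₂ e , ℕₚ.n≤0⇒n≡0 (ℕₚ.≮⇒≥ 0≮ℓ)))
    step (suc k) (s≤s k<ℓ) rewrite vertex-< k k<ℓ with suc k <? ℓ a c
    ... | yes 1+k<ℓ = from (ι-adj⇔ (inj₂ _) (inj₂ _))
          (refl , refl , inj₁ (trans (cong suc (Finₚ.toℕ-fromℕ< k<ℓ)) (sym (Finₚ.toℕ-fromℕ< 1+k<ℓ))))
    ... | no 1+k≮ℓ = from (ι-adj⇔ (inj₂ _) (inj₁ c))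
          (inj₂ (refl , trans (cong suc (Finₚ.toℕ-fromℕ< k<ℓ)) (ℕₚ.≤-antisym k<ℓ (ℕₚ.≮⇒≥ 1+k≮ℓ))))

    walk : Walk G (λ _ → ⊤) (x a) (x c)
    walk = record { L = suc (ℓ a c) ; w = vertex ; w0 = refl ; wL = vertex-≮ (ℓ a c) (ℕₚ.<-irrefl refl)
                  ; inS = λ _ _ → tt ; st = step }

  open BranchWalk

  pathSet : ∀ a c → Dec (Edge H a c) → Subset (n G)
  pathSet a c (yes e) = rangeSet (walk e)
  pathSet a c (no _) = ⊥

  S : Fin h → Fin h → Subset (n G)
  S a c = pathSet a c (edge? H a c)

  S-elim : (P : Subset (n G) → Set) → (∀ e → P (rangeSet (walk e))) → Edge H a c → P (S a c)
  S-elim {a} {c} P P-walk e with edge? H a c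
  ... | yes e′ = P-walk e′
  ... | no ¬e = contradiction e ¬e

  interior⇒interiorVertex : (e : Edge H a c) → ∀ {v} → v ∈ rangeSet (walk e) ─ (B a ∪ B c) →
                            ∃ λ i → interiorVertex e i ≡ v
  interior⇒interiorVertex {a} {c} e {v} v∈ with to ∈-subsetOf⇔ (p─q⊆p (rangeSet (walk e)) _ v∈)
  ... | zero , _ , refl = contradiction (x∈p∪q⁺ (inj₁ (x∈⁅x⁆ (x a)))) (x∈p─q⇒x∉q v∈)
  ... | suc k , _ , refl = by-bound (k <? ℓ a c)
    where
    by-bound : Dec (k < ℓ a c) → ∃ λ i → interiorVertex e i ≡ vertex e (suc k)
    by-bound (yes k<ℓ) = fromℕ< k<ℓ , sym (vertex-< e k k<ℓ)
    by-bound (no k≮ℓ) = contradiction (x∈p∪q⁺ (inj₂ (subst (_∈ B c) (sym (vertex-≮ e k k≮ℓ)) (x∈⁅x⁆ (x c)))))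
                                      (x∈p─q⇒x∉q v∈)

  subdivisionSets : SubdivisionSets H G x B S
  subdivisionSets = record
    { B-size = λ a → ∣⁅x⁆∣≡1 (x a)
    ; x∈B = λ a → x∈⁅x⁆ (x a)
    ; x-injective = λ a c a≢c xa≡xc → a≢c (Sumₚ.inj₁-injective (ι-injective xa≡xc))
    ; non-edge = λ a c ¬ac xa~xc →
        [ ¬ac ∘ proj₁ ∘ proj₂ , ¬ac ∘ Adj-sym H ∘ proj₁ ∘ proj₂ ] (to (ι-adj⇔ (inj₁ a) (inj₁ c)) xa~xc)
    ; start∈S = λ a c → S-elim (x a ∈_) (λ e → from ∈-subsetOf⇔ (start∈Range (walk e)))
    ; end∈S = λ a c → S-elim (x c ∈_) (λ e → from ∈-subsetOf⇔ (end∈Range (walk e)))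
    ; S-connected = λ a c → S-elim (λ Z → Connected G (_∈ Z)) (rangeSet-connected ∘ walk)
    ; interior-apart-branch = λ a c e b b∉ac →
        S-elim (λ Z → Apart G (Z ─ (B a ∪ B c)) (B b)) (λ e′ → inner-apart-branch e′ b∉ac) e
    ; interior-apart-interior = λ a c e b d e′ bd≢ac →
        S-elim (λ Z → Apart G (Z ─ (B a ∪ B c)) (interior H G B S b d))
               (λ f → S-elim (λ Z → Apart G (rangeSet (walk f) ─ (B a ∪ B c)) (Z ─ (B b ∪ B d)))
                             (λ f′ → inner-apart-inner f f′ bd≢ac) e′) e }
    where
    inner-apart-branch : (e : Edge H a c) → ¬ (b ≡ a ⊎ b ≡ c) → Apart G (rangeSet (walk e) ─ (B a ∪ B c)) (B b)
    inner-apart-branch {b = b} e b∉ac v∈ y∈ with interior⇒interiorVertex e v∈ | x∈⁅y⁆⇒x≡y (x b) y∈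
    ... | i , refl | refl =
      (λ v≡xb → case ι-injective v≡xb of λ ()) ,
      (λ v~xb → b∉ac (Sum.map proj₁ proj₁ (to (ι-adj⇔ (inj₂ _) (inj₁ b)) v~xb)))
    inner-apart-inner : (e : Edge H a c) (e′ : Edge H b d) → ¬ (b ≡ a × d ≡ c) →
                        Apart G (rangeSet (walk e) ─ (B a ∪ B c)) (rangeSet (walk e′) ─ (B b ∪ B d))
    inner-apart-inner e e′ bd≢ac v∈ w∈ with interior⇒interiorVertex e v∈ | interior⇒interiorVertex e′ w∈
    ... | i , refl | j , refl =
      (λ v≡w → case ι-injective v≡w of λ { refl → bd≢ac (refl , refl) }) ,
      (λ v~w → let (a≡b , c≡d , _) = to (ι-adj⇔ (inj₂ _) (inj₂ _)) v~w in bd≢ac (sym a≡b , sym c≡d))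

subdivisionSets⇔inducedTopMinor : (H G : Graph) →
  (∃ λ x → ∃ λ B → ∃ λ S → SubdivisionSets H G x B S) ⇔ InducedTopMinor H G
subdivisionSets⇔inducedTopMinor H G = mk⇔
  (λ (_ , _ , _ , sets) → SubdivisionFromSets.inducedTopMinor H G sets)
  (λ (ℓ , ι , ι-injective , ι-adj⇔) →
     _ , _ , _ , SetsFromSubdivision.subdivisionSets H G ℓ ι ι-injective ι-adj⇔)

itm-expressible : ∀ H → Expressible (InducedTopMinor H)
itm-expressible H = ∃ᵛ* h (∃ˢ* h (∃ˢ* (h * h) (qf (subdivisionFormula H)))) , λ G →
  subdivisionSets⇔inducedTopMinor H G ⇔-∘ mk⇔ (⇒ G) (⇐ G)
  where
  h : ℕ
  h = n H
  module _ (G : Graph) where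
    G′ : CGraph 0
    G′ = plain G
    ⇒ : plain G ⊨ ∃ᵛ* h (∃ˢ* h (∃ˢ* (h * h) (qf (subdivisionFormula H)))) →
        ∃ λ x → ∃ λ B → ∃ λ S → SubdivisionSets H G x B S
    ⇒ ⊨φ =
      let (xs , ⊨φ₁) = to (∃ᵛ*⇔ G′ (λ ()) (λ ()) h _) ⊨φ
          (Bs , ⊨φ₂) = to (∃ˢ*⇔ G′ (prepend G′ h xs (λ ())) (λ ()) h _) ⊨φ₁
          (Ss , ⊨φ₃) = to (∃ˢ*⇔ G′ (prepend G′ h xs (λ ())) (prepend G′ h Bs (λ ())) (h * h) _) ⊨φ₂
      in _ , _ , _ , to (subdivisionFormula⇔ H G _ _) ⊨φ₃
    ⇐ : (∃ λ x → ∃ λ B → ∃ λ S → SubdivisionSets H G x B S) →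
        plain G ⊨ ∃ᵛ* h (∃ˢ* h (∃ˢ* (h * h) (qf (subdivisionFormula H))))
    ⇐ (x , B , S , sets) =
      from (∃ᵛ*⇔ G′ (λ ()) (λ ()) h _) (x ,
      from (∃ˢ*⇔ G′ ρ (λ ()) h _) (B ,
      from (∃ˢ*⇔ G′ ρ (prepend G′ h B (λ ())) (h * h) _) (Ss ,
      from (subdivisionFormula⇔ H G ρ η) (SubdivisionSets-resp H G x≗ B≗ S≗ sets))))
      where
      ρ : Fin (h + 0) → Fin (n G)
      ρ = prepend G′ h x (λ ())
      Ss : Fin (h * h) → Subset (n G)
      Ss = uncurry S ∘ remQuot h
      η : Fin (h * h + (h + 0)) → Subset (n G)
      η = prepend G′ (h * h) Ss (prepend G′ h B (λ ()))
      x≗ : ∀ a → x a ≡ ρ (branchVar H a)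
      x≗ a = sym (prepend-↑ˡ G′ h x (λ ()) a)
      B≗ : ∀ a → B a ≡ η (branchSetVar H a)
      B≗ a = sym (trans (prepend-↑ʳ G′ (h * h) Ss _ (a ↑ˡ 0)) (prepend-↑ˡ G′ h B (λ ()) a))
      S≗ : ∀ a c → S a c ≡ η (pathSetVar H a c)
      S≗ a c =
        sym (trans (prepend-↑ˡ G′ (h * h) Ss _ (combine a c)) (cong (uncurry S) (Finₚ.remQuot-combine a c)))

proposition6p6 :
    -- 1. Feedback Vertex Set
    (∀ (k : ℕ) → Σ (Sentence 0) λ φ →
        ∀ (G : Graph) → (plain G ⊨ φ) ⇔ FVS G k)
    -- 2. Longest Induced Path
    × (∀ (k : ℕ) → Σ (Sentence 0) λ φ →
        ∀ (G : Graph) → (plain G ⊨ φ) ⇔ LIP G k)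
    -- 3. Induced Disjoint Paths, with P i = {s i , t i}
    × (∀ (k : ℕ) → Σ (Sentence k) λ φ →
        ∀ (G : CGraph k) (s t : Fin k → Fin (n (graph G))) →
          (∀ i v → (P G i v ≡ true) ⇔ (v ≡ s i ⊎ v ≡ t i)) →
          (G ⊨ φ) ⇔ IDP (graph G) s t)
    -- 4. H-Induced Topological Minor
    × (∀ (H : Graph) → Σ (Sentence 0) λ φ →
        ∀ (G : Graph) → (plain G ⊨ φ) ⇔ InducedTopMinor H G)
    -- 5. Acyclic k-Colouring
    × (∀ (k : ℕ) → Σ (Sentence 0) λ φ →
        ∀ (G : Graph) → (plain G ⊨ φ) ⇔ AcyclicColoring G k)
proposition6p6 =
  fvs-expressible , lip-expressible , idp-expressible , itm-expressible , acyclicColouring-expressible
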